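{- Let $n\ge t\ge 2$, let $X$ be an $n$-element set, and let $s(n,t)$ denote the smallest number $s$ such that every family $\mathcal{F}\subset 2^X$ with $|\mathcal{F}|\ge s$ is $t$-separable. Then: (i) $s(n,2)=n+2$; (ii) $s(n,3)=\lfloor\frac{n^2}{4}\rfloor+n+2$; (iii) for $t=4$ or $t=5$ (fixed) and $n\to\infty$, $s(n,t)=\left(\frac{n}{t-1}\right)^{t-1}+\Theta(n^{t-2})$; (iv) for $t\ge 6$, $\left(\frac{n}{t-1}\right)^{t-1}<s(n,t)\le 1+\sum_{i=0}^{t-1}\binom{n}{i}$.
   Context: A family $\mathcal{F}\subset 2^X$ is called $t$-separable if there is a $t$-element subset $T\subset X$ such that for every ordered pair $x,y\in T$ with $x\neq y$ there exists $F\in\mathcal{F}$ with $F\cap\{x,y\}=\{x\}$. -}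

module Defs where

open import Data.Nat as ℕ using (ℕ; zero; suc; _≥_; _≤_)
open import Data.Fin using (Fin)
open import Data.Fin.Subset using (Subset; _∈_; _∉_; ∣_∣)
open import Data.List using (List; length)
open import Data.List.Membership.Propositional using () renaming (_∈_ to _∈ₗ_)
open import Data.List.Relation.Unary.Unique.Propositional using (Unique)
open import Data.Product using (Σ; _×_; ∃; ∃-syntax)
open import Data.Integer using (+_)
open import Data.Rational as ℚ using (ℚ; 1ℚ)
open import Relation.Binary.PropositionalEquality using (_≡_; _≢_)

-- The ground set X is Fin n; a subset of X is a 'Subset n'.
-- A family F ⊆ 2^X is a duplicate-free list of subsets; |F| = its length.
record Family (n : ℕ) : Set where
  constructor family
  field
    members  : List (Subset n)
    distinct : Unique members

open Family public

size : ∀ {n} → Family n → ℕ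
size 𝓕 = length (members 𝓕)

-- t-separable: there is a t-element T ⊆ X such that for every ordered pair
-- x ≠ y in T some member F satisfies F ∩ {x,y} = {x}, i.e. x ∈ F and y ∉ F.
Separable : ∀ {n} → ℕ → Family n → Set
Separable {n} t 𝓕 =
  ∃[ T ] (∣ T ∣ ≡ t ×
    (∀ (x y : Fin n) → x ∈ T → y ∈ T → x ≢ y →
       ∃[ F ] (F ∈ₗ members 𝓕 × x ∈ F × y ∉ F)))

AllSep : ℕ → ℕ → ℕ → Set
AllSep n t s = ∀ (𝓕 : Family n) → size 𝓕 ≥ s → Separable t 𝓕

IsSnt : ℕ → ℕ → ℕ → Set
IsSnt n t s = AllSep n t s × (∀ s' → AllSep n t s' → s ≤ s')

_^ℚ_ : ℚ → ℕ → ℚ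
q ^ℚ zero  = 1ℚ
q ^ℚ suc k = q ℚ.* (q ^ℚ k)

fromℕ : ℕ → ℚ
fromℕ n = + n ℚ./ 1

module Submission where

-- Encode a family Φ by its characteristic function and keep a set A of active
-- coordinates outside which all members agree (initially everything). Call x, y ∈ A neighbours
-- if each is separated from the other. If no w + 2 points of A are pairwise neighbours, a greedy
-- Turán-type argument finds x ∈ A with at most w/(w+1)·|A| neighbours in A. Compressing at x
-- writes |Φ| as the size of the shadow of Φ at x, which keeps its separation bound but loses the
-- active coordinate x, plus the number of pairs G, G ∪ {x} in Φ; the latter form a family whose
-- active set is A ∩ N(x) and whose separation number drops by one, since x can be added to any
-- of its separated sets. This gives recurrences h(m+1) ≥ h(m) + g(d) for d ≤ w(m+1)/(w+1),
-- solved in closed form for t ≤ 5 and by Pascal's rule (the Sauer–Shelah bound) in general.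
--
-- Lower bounds. A product of chains of lengths b₁, …, bₖ on disjoint blocks has ∏(bᵢ + 1)
-- members but no k + 1 separated points; nearly equal blocks give s(n,t) > (n/(t−1))^(t−1).

open import Defs

open import Data.Bool using (Bool; true; false; not; _∧_; _∨_; if_then_else_; T)
open import Data.Bool.Properties using (T-∧; T-∨) renaming (_≟_ to _≟ᵇ_)
open import Data.Empty using (⊥-elim)
open import Data.Fin using (Fin; zero; suc; _↑ʳ_)
open import Data.Fin.Properties using (any?; all?; ↑ʳ-injective)
  renaming (_≟_ to _≟ᶠ_; suc-injective to Fin-suc-injective)
open import Data.Fin.Subset using (Subset; inside; outside; _∈_; _∉_; _⊆_; _∩_; ⊥; ⊤; ⁅_⁆; ∣_∣; Nonempty)
open import Data.Fin.Subset.Properties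
  using (_∈?_; ∉⊥; ∈⊤; ⊥⊆; ⊆⊤; s⊆s; in⊆in; drop-∷-⊆; ⊆-antisym; x∈⁅y⁆⇒x≡y; x∈p∩q⁺; x∈p∩q⁻;
         ∣⊥∣≡0; ∣⊤∣≡n; ∣⁅x⁆∣≡1; p⊆q⇒∣p∣≤∣q∣; nonempty?; Empty-unique; anySubset?)
open import Data.Integer as ℤ using (+_)
import Data.Integer.Properties as ℤ
open import Data.Integer.Tactic.RingSolver using () renaming (solve-∀ to ℤ-solve-∀)
open import Data.List using (List; []; _∷_; length; map; _++_; replicate; applyUpTo; upTo)
open import Data.List.Membership.Propositional using (find; lose) renaming (_∈_ to _∈ₗ_)
open import Data.List.Membership.Propositional.Properties using (∈-map⁻; ∈-++⁻)
open import Data.List.Properties using (length-++; length-map; length-replicate)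
open import Data.List.Relation.Unary.All as All using ([])
open import Data.List.Relation.Unary.AllPairs using ([]; _∷_)
open import Data.List.Relation.Unary.Any using (here; there) renaming (any? to anyₗ?)
open import Data.List.Relation.Unary.Unique.Propositional using (Unique)
import Data.List.Relation.Unary.Unique.Propositional.Properties as Unique
open import Data.Nat
  using (ℕ; zero; suc; NonZero; _+_; _*_; _^_; _/_; _≤_; _<_; _≥_; _≤′_; ≤′-refl; ≤′-step; z≤n; s≤s;
         _≟_; ⌊_/2⌋; ⌈_/2⌉)
open import Data.Nat.Combinatorics using (_C_; nCk+nC[k+1]≡[n+1]C[k+1])
open import Data.Nat.DivMod using (_%_; m≡m%n+[m/n]*n; m%n<n; m*n/n≡m; m/n*n≤m; +-distrib-/-∣ʳ; /-monoˡ-≤)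
open import Data.Nat.Divisibility using (n∣m*n)
open import Data.Nat.ListAction using (sum; product)
open import Data.Nat.Properties
  using (module ≤-Reasoning; ≤-refl; ≤-reflexive; ≤-trans; ≤-antisym; ≤-pred; <⇒≤; <-irrefl; <-≤-trans; _≤?_; ≰⇒>;
         ≤ᵇ⇒≤; ≤⇒≤′; n≤1+n; n<1+n; m≤m+n; m≤n+m; m≤n⇒m≤1+n; suc-injective;
         +-comm; +-assoc; +-suc; +-identityʳ; +-mono-≤; +-monoˡ-≤; +-monoʳ-≤; +-cancelʳ-≤;
         *-comm; *-assoc; *-suc; *-zeroʳ; *-identityˡ; *-identityʳ; *-distribˡ-+; *-mono-≤; *-monoˡ-≤; *-monoʳ-≤;
         *-cancelˡ-≤; +-commutativeSemigroup; m^n>0; ^-monoˡ-≤; ^-monoˡ-<; ⌊n/2⌋-mono; ⌊n/2⌋+⌈n/2⌉≡n; n≡⌊n+n/2⌋)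
open import Algebra.Properties.CommutativeSemigroup +-commutativeSemigroup
  using () renaming (interchange to +-interchange)
open import Data.Nat.Tactic.RingSolver using (solve-∀)
open import Data.Product using (∃; ∃-syntax; _×_; _,_; proj₁; proj₂)
open import Data.Rational as ℚ using (ℚ; 0ℚ; 1ℚ)
import Data.Rational.Properties as ℚ
open import Data.Rational.Solver using (module +-*-Solver)
import Data.Rational.Unnormalised as ℚᵘ
import Data.Rational.Unnormalised.Properties as ℚᵘ
open import Data.Sum using (_⊎_; inj₁; inj₂; [_,_]′)
open import Data.Unit using (tt)
open import Data.Vec using ([]; _∷_; lookup; tabulate; drop; here; there; _[_]≔_)
open import Data.Vec.Properties
  using (≡-dec; ∷-injectiveˡ; ∷-injectiveʳ; lookup∘tabulate; []=⇒lookup; lookup⇒[]=; []≔-updates; []≔-minimal)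
open import Function using (_∘_; case_of_; Equivalence)
open import Relation.Binary.PropositionalEquality
open import Relation.Nullary using (¬_; Dec; yes; no; does)
open import Relation.Nullary.Decidable
  using (_×-dec_; _→-dec_; ¬?; T?; map′; dec-true; dec-false; toWitness; True)

sumSubsets : ∀ n → (Subset n → ℕ) → ℕ
sumSubsets zero    f = f []
sumSubsets (suc n) f = sumSubsets n (f ∘ (outside ∷_)) + sumSubsets n (f ∘ (inside ∷_))

sumSubsets-cong : ∀ n {f g : Subset n → ℕ} → (∀ v → f v ≡ g v) → sumSubsets n f ≡ sumSubsets n g
sumSubsets-cong zero    f≗g = f≗g []
sumSubsets-cong (suc n) f≗g =
  cong₂ _+_ (sumSubsets-cong n (f≗g ∘ (outside ∷_))) (sumSubsets-cong n (f≗g ∘ (inside ∷_)))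

sumSubsets-distrib-+ : ∀ n (f g : Subset n → ℕ) →
  sumSubsets n (λ v → f v + g v) ≡ sumSubsets n f + sumSubsets n g
sumSubsets-distrib-+ zero    f g = refl
sumSubsets-distrib-+ (suc n) f g
  rewrite sumSubsets-distrib-+ n (f ∘ (outside ∷_)) (g ∘ (outside ∷_))
        | sumSubsets-distrib-+ n (f ∘ (inside ∷_)) (g ∘ (inside ∷_)) =
  +-interchange (sumSubsets n (f ∘ (outside ∷_))) (sumSubsets n (g ∘ (outside ∷_)))
                (sumSubsets n (f ∘ (inside ∷_))) (sumSubsets n (g ∘ (inside ∷_)))

sumSubsets-zero : ∀ n → sumSubsets n (λ _ → 0) ≡ 0
sumSubsets-zero zero    = refl
sumSubsets-zero (suc n) rewrite sumSubsets-zero n = refl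

term≤sumSubsets : ∀ n (f : Subset n → ℕ) v → f v ≤ sumSubsets n f
term≤sumSubsets zero    f []            = ≤-refl
term≤sumSubsets (suc n) f (outside ∷ v) = ≤-trans (term≤sumSubsets n _ v) (m≤m+n _ _)
term≤sumSubsets (suc n) f (inside ∷ v)  = ≤-trans (term≤sumSubsets n _ v) (m≤n+m _ _)

sumSubsets-pos : ∀ n (f : Subset n → ℕ) → 0 < sumSubsets n f → ∃ λ v → 0 < f v
sumSubsets-pos zero    f pos = [] , pos
sumSubsets-pos (suc n) f pos with sumSubsets n (f ∘ (outside ∷_)) in eq
... | suc _ = let v , fv>0 = sumSubsets-pos n _ (subst (0 <_) (sym eq) (s≤s z≤n)) in outside ∷ v , fv>0
... | zero  = let v , fv>0 = sumSubsets-pos n _ pos in inside ∷ v , fv>0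

sumSubsets-pairs : ∀ n (x : Fin n) (f : Subset n → ℕ) →
  sumSubsets n f ≡ sumSubsets n (λ v → if lookup v x then 0 else f v + f (v [ x ]≔ inside))
sumSubsets-pairs (suc n) zero f
  rewrite sumSubsets-distrib-+ n (f ∘ (outside ∷_)) (f ∘ (inside ∷_)) | sumSubsets-zero n = sym (+-identityʳ _)
sumSubsets-pairs (suc n) (suc x) f = cong₂ _+_ (sumSubsets-pairs n x _) (sumSubsets-pairs n x _)

∈-[]≔⁻ : ∀ {n} {p : Subset n} {x y b} → y ∈ p [ x ]≔ b → y ≢ x → y ∈ p
∈-[]≔⁻ {p = _ ∷ _} {zero}  {zero}  _          y≢x = ⊥-elim (y≢x refl)
∈-[]≔⁻ {p = _ ∷ _} {zero}  {suc _} (there y∈) _   = there y∈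
∈-[]≔⁻ {p = _ ∷ _} {suc _} {zero}  here       _   = here
∈-[]≔⁻ {p = _ ∷ _} {suc _} {suc _} (there y∈) y≢x = there (∈-[]≔⁻ y∈ (y≢x ∘ cong suc))

∈-insert⁻ : ∀ {n} {p : Subset n} {x y} → y ∈ p [ x ]≔ inside → y ≡ x ⊎ y ∈ p
∈-insert⁻ {x = x} {y} y∈ with y ≟ᶠ x
... | yes y≡x = inj₁ y≡x
... | no  y≢x = inj₂ (∈-[]≔⁻ y∈ y≢x)

T-not-lookup⇒∉ : ∀ {n} {p : Subset n} {x} → T (not (lookup p x)) → x ∉ p
T-not-lookup⇒∉ x∉p x∈p = subst (T ∘ not) ([]=⇒lookup x∈p) x∉p

x∉p[x]≔outside : ∀ {n} (p : Subset n) x → x ∉ p [ x ]≔ outside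
x∉p[x]≔outside p x x∈ with trans (sym ([]=⇒lookup x∈)) ([]=⇒lookup ([]≔-updates p x))
... | ()

x∉p⇒∣p[x]≔inside∣≡1+∣p∣ : ∀ {n} (p : Subset n) x → x ∉ p → ∣ p [ x ]≔ inside ∣ ≡ suc ∣ p ∣
x∉p⇒∣p[x]≔inside∣≡1+∣p∣ (outside ∷ p) zero    _   = refl
x∉p⇒∣p[x]≔inside∣≡1+∣p∣ (inside ∷ p)  zero    x∉p = ⊥-elim (x∉p here)
x∉p⇒∣p[x]≔inside∣≡1+∣p∣ (outside ∷ p) (suc x) x∉p = x∉p⇒∣p[x]≔inside∣≡1+∣p∣ p x (x∉p ∘ there)
x∉p⇒∣p[x]≔inside∣≡1+∣p∣ (inside ∷ p)  (suc x) x∉p = cong suc (x∉p⇒∣p[x]≔inside∣≡1+∣p∣ p x (x∉p ∘ there))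

x∈p⇒1+∣p[x]≔outside∣≡∣p∣ : ∀ {n} (p : Subset n) x → x ∈ p → suc ∣ p [ x ]≔ outside ∣ ≡ ∣ p ∣
x∈p⇒1+∣p[x]≔outside∣≡∣p∣ (inside ∷ p)  zero    _          = refl
x∈p⇒1+∣p[x]≔outside∣≡∣p∣ (outside ∷ p) (suc x) (there x∈) = x∈p⇒1+∣p[x]≔outside∣≡∣p∣ p x x∈
x∈p⇒1+∣p[x]≔outside∣≡∣p∣ (inside ∷ p)  (suc x) (there x∈) = cong suc (x∈p⇒1+∣p[x]≔outside∣≡∣p∣ p x x∈)

x∈p⇒⁅x⁆⊆p : ∀ {n} {p : Subset n} {x} → x ∈ p → ⁅ x ⁆ ⊆ p
x∈p⇒⁅x⁆⊆p {x = x} x∈p y∈⁅x⁆ = subst (_∈ _) (sym (x∈⁅y⁆⇒x≡y x y∈⁅x⁆)) x∈p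

x∈p⇒0<∣p∣ : ∀ {n} {p : Subset n} {x} → x ∈ p → 0 < ∣ p ∣
x∈p⇒0<∣p∣ {x = x} x∈p = subst (_≤ _) (∣⁅x⁆∣≡1 x) (p⊆q⇒∣p∣≤∣q∣ (x∈p⇒⁅x⁆⊆p x∈p))

x∈q⇒p[x]≔inside⊆q : ∀ {n} {p q : Subset n} {x} → x ∈ q → p ⊆ q → p [ x ]≔ inside ⊆ q
x∈q⇒p[x]≔inside⊆q {q = q} x∈q p⊆q = [ (λ y≡x → subst (_∈ q) (sym y≡x) x∈q) , p⊆q ]′ ∘ ∈-insert⁻

0<∣p∣⇒Nonempty : ∀ {n} (p : Subset n) → 0 < ∣ p ∣ → Nonempty p
0<∣p∣⇒Nonempty {n} p 0<∣p∣ with nonempty? p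
... | yes ne = ne
... | no  ¬ne =
  ⊥-elim (<-irrefl refl (subst (0 <_) (∣⊥∣≡0 n) (subst (λ q → 0 < ∣ q ∣) (Empty-unique ¬ne) 0<∣p∣)))

∃-⊆-of-size : ∀ {n} k (S : Subset n) → k ≤ ∣ S ∣ → ∃ λ S′ → S′ ⊆ S × ∣ S′ ∣ ≡ k
∃-⊆-of-size {n} zero S _ = ⊥ , ⊥⊆ , ∣⊥∣≡0 n
∃-⊆-of-size (suc k) (inside ∷ S) (s≤s k≤∣S∣) =
  let S′ , S′⊆S , ∣S′∣≡k = ∃-⊆-of-size k S k≤∣S∣ in inside ∷ S′ , in⊆in S′⊆S , cong suc ∣S′∣≡k
∃-⊆-of-size (suc k) (outside ∷ S) k<∣S∣ =
  let S′ , S′⊆S , ∣S′∣≡k = ∃-⊆-of-size (suc k) S k<∣S∣ in outside ∷ S′ , s⊆s S′⊆S , ∣S′∣≡k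

-- |p| - |p ∩ r| = |p ∖ r| ≤ |q ∖ r| = |q| - |q ∩ r|, with the subtractions moved across.
p⊆q⇒∣p∣+∣q∩r∣≤∣p∩r∣+∣q∣ : ∀ {n} (p q r : Subset n) → p ⊆ q →
                           ∣ p ∣ + ∣ q ∩ r ∣ ≤ ∣ p ∩ r ∣ + ∣ q ∣
p⊆q⇒∣p∣+∣q∩r∣≤∣p∩r∣+∣q∣ [] [] [] _ = z≤n
p⊆q⇒∣p∣+∣q∩r∣≤∣p∩r∣+∣q∣ (inside ∷ p) (outside ∷ q) (_ ∷ r) p⊆q with p⊆q here
... | ()
p⊆q⇒∣p∣+∣q∩r∣≤∣p∩r∣+∣q∣ (inside ∷ p) (inside ∷ q) (inside ∷ r) p⊆q
  rewrite +-suc ∣ p ∣ ∣ q ∩ r ∣ | +-suc ∣ p ∩ r ∣ ∣ q ∣ =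
  s≤s (s≤s (p⊆q⇒∣p∣+∣q∩r∣≤∣p∩r∣+∣q∣ p q r (drop-∷-⊆ p⊆q)))
p⊆q⇒∣p∣+∣q∩r∣≤∣p∩r∣+∣q∣ (inside ∷ p) (inside ∷ q) (outside ∷ r) p⊆q
  rewrite +-suc ∣ p ∩ r ∣ ∣ q ∣ = s≤s (p⊆q⇒∣p∣+∣q∩r∣≤∣p∩r∣+∣q∣ p q r (drop-∷-⊆ p⊆q))
p⊆q⇒∣p∣+∣q∩r∣≤∣p∩r∣+∣q∣ (outside ∷ p) (inside ∷ q) (inside ∷ r) p⊆q
  rewrite +-suc ∣ p ∣ ∣ q ∩ r ∣ | +-suc ∣ p ∩ r ∣ ∣ q ∣ =
  s≤s (p⊆q⇒∣p∣+∣q∩r∣≤∣p∩r∣+∣q∣ p q r (drop-∷-⊆ p⊆q))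
p⊆q⇒∣p∣+∣q∩r∣≤∣p∩r∣+∣q∣ (outside ∷ p) (inside ∷ q) (outside ∷ r) p⊆q
  rewrite +-suc ∣ p ∩ r ∣ ∣ q ∣ = m≤n⇒m≤1+n (p⊆q⇒∣p∣+∣q∩r∣≤∣p∩r∣+∣q∣ p q r (drop-∷-⊆ p⊆q))
p⊆q⇒∣p∣+∣q∩r∣≤∣p∩r∣+∣q∣ (outside ∷ p) (outside ∷ q) (_ ∷ r) p⊆q =
  p⊆q⇒∣p∣+∣q∩r∣≤∣p∩r∣+∣q∣ p q r (drop-∷-⊆ p⊆q)

Fam : ℕ → Set
Fam n = Subset n → Bool

indicator : Bool → ℕ
indicator true  = 1
indicator false = 0

∣_∣ᶠ : ∀ {n} → Fam n → ℕ
∣_∣ᶠ {n} Φ = sumSubsets n (indicator ∘ Φ)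

Separates : ∀ {n} → Fam n → Fin n → Fin n → Set
Separates Φ x y = ∃ λ G → T (Φ G) × x ∈ G × y ∉ G

separates? : ∀ {n} (Φ : Fam n) x y → Dec (Separates Φ x y)
separates? Φ x y = anySubset? λ G → T? (Φ G) ×-dec x ∈? G ×-dec ¬? (y ∈? G)

¬Separates-refl : ∀ {n} (Φ : Fam n) x → ¬ Separates Φ x x
¬Separates-refl Φ x (_ , _ , x∈G , x∉G) = x∉G x∈G

SeparatedSet : ∀ {n} → Fam n → Subset n → Set
SeparatedSet {n} Φ S = ∀ (x y : Fin n) → x ∈ S → y ∈ S → x ≢ y → Separates Φ x y

SeparationBound : ∀ {n} → Fam n → Subset n → ℕ → Set
SeparationBound Φ A w = ∀ S → S ⊆ A → SeparatedSet Φ S → ∣ S ∣ ≤ w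

AgreeOutside : ∀ {n} → Fam n → Subset n → Set
AgreeOutside Φ A = ∀ {G H} → T (Φ G) → T (Φ H) → ∀ {y} → y ∉ A → y ∈ G → y ∈ H

neighbours : ∀ {n} → Fam n → Fin n → Subset n
neighbours Φ x = tabulate λ y → does (separates? Φ x y) ∧ does (separates? Φ y x)

∈-neighbours⁻ : ∀ {n} (Φ : Fam n) x y → y ∈ neighbours Φ x → Separates Φ x y × Separates Φ y x
∈-neighbours⁻ Φ x y y∈ with separates? Φ x y | separates? Φ y x
                          | trans (sym (lookup∘tabulate _ y)) ([]=⇒lookup y∈)
... | yes xy | yes yx | _  = xy , yx
... | yes _  | no _   | ()
... | no _   | _      | ()

∈-neighbours⁺ : ∀ {n} (Φ : Fam n) x y → Separates Φ x y → Separates Φ y x → y ∈ neighbours Φ x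
∈-neighbours⁺ Φ x y xy yx = lookup⇒[]= y _ (trans (lookup∘tabulate _ y)
  (cong₂ _∧_ (dec-true (separates? Φ x y) xy) (dec-true (separates? Φ y x) yx)))

x∉neighbours : ∀ {n} (Φ : Fam n) x → x ∉ neighbours Φ x
x∉neighbours Φ x x∈ = ¬Separates-refl Φ x (proj₁ (∈-neighbours⁻ Φ x x x∈))

indicator-pos : ∀ b → 0 < indicator b → T b
indicator-pos true _ = tt

indicator-¬T : ∀ b → ¬ T b → indicator b ≡ 0
indicator-¬T true  ¬b = ⊥-elim (¬b tt)
indicator-¬T false _  = refl

indicator≤1 : ∀ b → indicator b ≤ 1
indicator≤1 true  = ≤-refl
indicator≤1 false = z≤n

∣Φ∣ᶠ≤1 : ∀ {n} (Φ : Fam n) → (∀ {G H} → T (Φ G) → T (Φ H) → G ≡ H) → ∣ Φ ∣ᶠ ≤ 1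
∣Φ∣ᶠ≤1 {zero}  Φ _ = indicator≤1 (Φ [])
∣Φ∣ᶠ≤1 {suc n} Φ unique with ∣ Φ ∘ (outside ∷_) ∣ᶠ in eq
... | zero  = ∣Φ∣ᶠ≤1 (Φ ∘ (inside ∷_)) λ G H → ∷-injectiveʳ (unique G H)
... | suc k = subst (λ m → suc k + m ≤ 1) (sym noInsideMembers)
                (subst (_≤ 1) (trans eq (sym (+-identityʳ (suc k))))
                       (∣Φ∣ᶠ≤1 (Φ ∘ (outside ∷_)) λ G H → ∷-injectiveʳ (unique G H)))
  where
  outsideMember : ∃ λ v → 0 < indicator (Φ (outside ∷ v))
  outsideMember = sumSubsets-pos n _ (subst (0 <_) (sym eq) (s≤s z≤n))
  noInsideMembers : ∣ Φ ∘ (inside ∷_) ∣ᶠ ≡ 0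
  noInsideMembers = trans (sumSubsets-cong n λ w → indicator-¬T (Φ (inside ∷ w)) λ Φw →
                              case ∷-injectiveˡ (unique (indicator-pos _ (proj₂ outsideMember)) Φw) of λ ())
                          (sumSubsets-zero n)

AgreeOutside-∅⇒∣Φ∣ᶠ≤1 : ∀ {n} (Φ : Fam n) A → AgreeOutside Φ A → (∀ {y} → y ∉ A) → ∣ Φ ∣ᶠ ≤ 1
AgreeOutside-∅⇒∣Φ∣ᶠ≤1 Φ A agree ∉A = ∣Φ∣ᶠ≤1 Φ λ ΦG ΦH → ⊆-antisym (agree ΦG ΦH ∉A) (agree ΦH ΦG ∉A)

SeparationBound-0⇒∉ : ∀ {n} (Φ : Fam n) A → SeparationBound Φ A 0 → ∀ {x} → x ∉ A
SeparationBound-0⇒∉ Φ A bound {x} x∈A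
  with subst (_≤ 0) (∣⁅x⁆∣≡1 x) (bound ⁅ x ⁆ (x∈p⇒⁅x⁆⊆p x∈A) singletonSeparated)
  where
  singletonSeparated : SeparatedSet Φ ⁅ x ⁆
  singletonSeparated y z y∈ z∈ y≢z = ⊥-elim (y≢z (trans (x∈⁅y⁆⇒x≡y x y∈) (sym (x∈⁅y⁆⇒x≡y x z∈))))
... | ()

-- Compression at a coordinate x

module Compression {n} (Φ : Fam n) (x : Fin n) where

  shadow : Fam n
  shadow G = not (lookup G x) ∧ (Φ G ∨ Φ (G [ x ]≔ inside))

  pairs : Fam n
  pairs G = not (lookup G x) ∧ (Φ G ∧ Φ (G [ x ]≔ inside))

  ∣Φ∣ᶠ≡∣shadow∣ᶠ+∣pairs∣ᶠ : ∣ Φ ∣ᶠ ≡ ∣ shadow ∣ᶠ + ∣ pairs ∣ᶠ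
  ∣Φ∣ᶠ≡∣shadow∣ᶠ+∣pairs∣ᶠ =
    trans (sumSubsets-pairs n x _) (trans (sumSubsets-cong n termwise) (sumSubsets-distrib-+ n _ _))
    where
    indicator-∨-∧ : ∀ a b → indicator a + indicator b ≡ indicator (a ∨ b) + indicator (a ∧ b)
    indicator-∨-∧ true  true  = refl
    indicator-∨-∧ true  false = refl
    indicator-∨-∧ false true  = refl
    indicator-∨-∧ false false = refl
    termwise : ∀ v → (if lookup v x then 0 else indicator (Φ v) + indicator (Φ (v [ x ]≔ inside)))
                     ≡ indicator (shadow v) + indicator (pairs v)
    termwise v with lookup v x
    ... | true  = refl
    ... | false = indicator-∨-∧ (Φ v) (Φ (v [ x ]≔ inside))

  shadow⁻ : ∀ {G} → T (shadow G) →
    x ∉ G × ∃ λ G′ → T (Φ G′) × (∀ {y} → y ≢ x → y ∈ G′ → y ∈ G)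
                              × (∀ {y} → y ≢ x → y ∈ G → y ∈ G′)
  shadow⁻ {G} shadowG with Equivalence.to (T-∧ {not (lookup G x)}) shadowG
  ... | x∉G , ΦG∨ΦG+x with Equivalence.to (T-∨ {Φ G}) ΦG∨ΦG+x
  ... | inj₁ ΦG   = T-not-lookup⇒∉ x∉G , G , ΦG , (λ _ y∈ → y∈) , (λ _ y∈ → y∈)
  ... | inj₂ ΦG+x = T-not-lookup⇒∉ x∉G , G [ x ]≔ inside , ΦG+x ,
                    (λ y≢x y∈ → ∈-[]≔⁻ y∈ y≢x) , (λ y≢x y∈ → []≔-minimal G _ x y≢x y∈)

  pairs⁻ : ∀ {G} → T (pairs G) → x ∉ G × T (Φ G) × T (Φ (G [ x ]≔ inside))
  pairs⁻ {G} pairsG =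
    let x∉G , ΦG∧ΦG+x = Equivalence.to (T-∧ {not (lookup G x)}) pairsG
    in T-not-lookup⇒∉ x∉G , Equivalence.to (T-∧ {Φ G}) ΦG∧ΦG+x

  agreeOutside-shadow : ∀ {A} → AgreeOutside Φ A → AgreeOutside shadow (A [ x ]≔ outside)
  agreeOutside-shadow {A} agree shadowG shadowH {y} y∉A-x y∈G with y ≟ᶠ x
  ... | yes refl = ⊥-elim (proj₁ (shadow⁻ shadowG) y∈G)
  ... | no  y≢x =
    let _ , G′ , ΦG′ , _    , G⊆G′ = shadow⁻ shadowG
        _ , H′ , ΦH′ , H′⊆H , _    = shadow⁻ shadowH
    in H′⊆H y≢x (agree ΦG′ ΦH′ (y∉A-x ∘ []≔-minimal A y x y≢x) (G⊆G′ y≢x y∈G))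

  separationBound-shadow : ∀ {A w} → SeparationBound Φ A w → SeparationBound shadow (A [ x ]≔ outside) w
  separationBound-shadow {A} bound S S⊆A-x separatedS = bound S S⊆A separatedΦ
    where
    ≢x : ∀ {y} → y ∈ S → y ≢ x
    ≢x y∈S refl = x∉p[x]≔outside A x (S⊆A-x y∈S)
    S⊆A : S ⊆ A
    S⊆A y∈S = ∈-[]≔⁻ (S⊆A-x y∈S) (≢x y∈S)
    separatedΦ : SeparatedSet Φ S
    separatedΦ u v u∈S v∈S u≢v =
      let G , shadowG , u∈G , v∉G = separatedS u v u∈S v∈S u≢v
          _ , G′ , ΦG′ , G′⊆G , G⊆G′ = shadow⁻ shadowG
      in G′ , ΦG′ , G⊆G′ (≢x u∈S) u∈G , v∉G ∘ G′⊆G (≢x v∈S)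

  agreeOutside-pairs : ∀ {A} → AgreeOutside Φ A → AgreeOutside pairs (A ∩ neighbours Φ x)
  agreeOutside-pairs {A} agree pairsG pairsH {y} y∉A∩N y∈G
    with pairs⁻ pairsG | pairs⁻ pairsH | y ∈? A
  ... | _ , ΦG , _ | _ , ΦH , _ | no y∉A = agree ΦG ΦH y∉A y∈G
  ... | x∉G , ΦG , _ | _ , _ , ΦH+x | yes y∈A = case y ∈? _ of λ where
      (yes y∈H) → y∈H
      (no  y∉H) → ⊥-elim (y∉A∩N (x∈p∩q⁺ (y∈A , ∈-neighbours⁺ Φ x y
                    (_ , ΦH+x , []≔-updates _ x , [ (λ y≡x → x∉G (subst (_∈ _) y≡x y∈G)) , y∉H ]′ ∘ ∈-insert⁻)
                    (_ , ΦG , y∈G , x∉G))))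

  separationBound-pairs : ∀ {A w} → x ∈ A → SeparationBound Φ A (suc w) →
                          SeparationBound pairs (A ∩ neighbours Φ x) w
  separationBound-pairs {A} {w} x∈A bound S S⊆A∩N separatedS =
    ≤-pred (subst (_≤ suc w) (x∉p⇒∣p[x]≔inside∣≡1+∣p∣ S x x∉S)
                  (bound (S [ x ]≔ inside) (x∈q⇒p[x]≔inside⊆q x∈A (proj₁ ∘ inA×inN)) separatedS+x))
    where
    N = neighbours Φ x
    inA×inN : ∀ {y} → y ∈ S → y ∈ A × y ∈ N
    inA×inN y∈S = x∈p∩q⁻ A N (S⊆A∩N y∈S)
    x∉S : x ∉ S
    x∉S x∈S = x∉neighbours Φ x (proj₂ (inA×inN x∈S))
    separatedS+x : SeparatedSet Φ (S [ x ]≔ inside)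
    separatedS+x u v u∈ v∈ u≢v with ∈-insert⁻ u∈ | ∈-insert⁻ v∈
    ... | inj₁ refl | inj₁ refl = ⊥-elim (u≢v refl)
    ... | inj₁ refl | inj₂ v∈S  = proj₁ (∈-neighbours⁻ Φ x v (proj₂ (inA×inN v∈S)))
    ... | inj₂ u∈S  | inj₁ refl = proj₂ (∈-neighbours⁻ Φ x u (proj₂ (inA×inN u∈S)))
    ... | inj₂ u∈S  | inj₂ v∈S  =
      let G , pairsG , u∈G , v∉G = separatedS u v u∈S v∈S u≢v in G , proj₁ (proj₂ (pairs⁻ pairsG)) , u∈G , v∉G

-- A Turán-type greedy step

private
  greedy-invariant-step : ∀ w m q q′ d j → suc w * suc m ≤ suc w * q + j * m → q + d ≤ q′ + suc m →
    suc (w * suc m) ≤ suc w * d → suc w * suc m ≤ suc w * q′ + suc j * m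
  greedy-invariant-step w m q q′ d j invariant q+d≤q′+m+1 dense = begin
    suc w * suc m              ≤⟨ invariant ⟩
    suc w * q + j * m          ≤⟨ +-monoˡ-≤ (j * m) Wq≤Wq′+m ⟩
    suc w * q′ + m + j * m     ≡⟨ +-assoc (suc w * q′) m (j * m) ⟩
    suc w * q′ + suc j * m     ∎
    where
    open ≤-Reasoning
    regroup : ∀ w q′ m → suc w * (q′ + suc m) ≡ suc w * q′ + m + suc (w * suc m)
    regroup = solve-∀
    Wq≤Wq′+m : suc w * q ≤ suc w * q′ + m
    Wq≤Wq′+m = +-cancelʳ-≤ (suc (w * suc m)) _ _ (begin
      suc w * q + suc (w * suc m)       ≤⟨ +-monoʳ-≤ (suc w * q) dense ⟩
      suc w * q + suc w * d             ≡⟨ sym (*-distribˡ-+ (suc w) q d) ⟩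
      suc w * (q + d)                   ≤⟨ *-monoʳ-≤ (suc w) q+d≤q′+m+1 ⟩
      suc w * (q′ + suc m)              ≡⟨ regroup w q′ m ⟩
      suc w * q′ + m + suc (w * suc m)  ∎)

  greedy-nonempty : ∀ w m q j → suc w * suc m ≤ suc w * q + j * m → j ≤ suc w → 0 < q
  greedy-nonempty w m zero j inv j≤W = ⊥-elim (<-irrefl refl (≤-trans W*m<W*[m+1] (≤-trans inv jm≤Wm)))
    where
    W*m<W*[m+1] : suc (suc w * m) ≤ suc w * suc m
    W*m<W*[m+1] rewrite *-suc (suc w) m = s≤s (m≤n+m _ w)
    jm≤Wm : suc w * 0 + j * m ≤ suc w * m
    jm≤Wm rewrite *-zeroʳ (suc w) = *-monoˡ-≤ m j≤W
  greedy-nonempty w m (suc q) j _ _ = s≤s z≤n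

-- If every vertex of A had more than a w/(w+1) fraction of A as neighbours, a greedy
-- choice would produce w + 2 pairwise mutually separated points of A.
module Greedy {n} (Φ : Fam n) (A : Subset n) (w m : ℕ) (∣A∣≡1+m : ∣ A ∣ ≡ suc m)
              (dense : ∀ x → x ∈ A → suc (w * suc m) ≤ suc w * ∣ A ∩ neighbours Φ x ∣) where

  record Partial (j : ℕ) : Set where
    field
      S Q       : Subset n
      S⊆A       : S ⊆ A
      separated : SeparatedSet Φ S
      ∣S∣≡j     : ∣ S ∣ ≡ j
      Q⊆A       : Q ⊆ A
      Q⊆N       : ∀ {u y} → u ∈ S → y ∈ Q → y ∈ neighbours Φ u
      large     : suc w * suc m ≤ suc w * ∣ Q ∣ + j * m

  start : Partial 0
  start = record
    { S = ⊥ ; Q = A ; S⊆A = ⊥⊆ ; separated = λ u _ u∈⊥ → ⊥-elim (∉⊥ u∈⊥) ; ∣S∣≡j = ∣⊥∣≡0 n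
    ; Q⊆A = λ y∈ → y∈ ; Q⊆N = λ u∈⊥ → ⊥-elim (∉⊥ u∈⊥)
    ; large = subst (λ k → suc w * suc m ≤ suc w * k + 0) (sym ∣A∣≡1+m) (m≤m+n _ _) }

  extend : ∀ {j} → j ≤ suc w → Partial j → Partial (suc j)
  extend {j} j≤W P = record
    { S = S [ x ]≔ inside ; Q = Q ∩ N
    ; S⊆A = x∈q⇒p[x]≔inside⊆q x∈A S⊆A
    ; separated = separated′
    ; ∣S∣≡j = trans (x∉p⇒∣p[x]≔inside∣≡1+∣p∣ S x x∉S) (cong suc ∣S∣≡j)
    ; Q⊆A = Q⊆A ∘ proj₁ ∘ x∈p∩q⁻ Q N
    ; Q⊆N = Q⊆N′
    ; large = greedy-invariant-step w m (∣ Q ∣) (∣ Q ∩ N ∣) (∣ A ∩ N ∣) j large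
                (subst (λ k → ∣ Q ∣ + ∣ A ∩ N ∣ ≤ ∣ Q ∩ N ∣ + k) ∣A∣≡1+m
                       (p⊆q⇒∣p∣+∣q∩r∣≤∣p∩r∣+∣q∣ Q A N Q⊆A))
                (dense x x∈A) }
    where
    open Partial P
    Q-nonempty : Nonempty Q
    Q-nonempty = 0<∣p∣⇒Nonempty Q (greedy-nonempty w m (∣ Q ∣) j large j≤W)
    x : Fin n
    x = proj₁ Q-nonempty
    x∈Q : x ∈ Q
    x∈Q = proj₂ Q-nonempty
    x∈A : x ∈ A
    x∈A = Q⊆A x∈Q
    N : Subset n
    N = neighbours Φ x
    x∉S : x ∉ S
    x∉S x∈S = x∉neighbours Φ x (Q⊆N x∈S x∈Q)
    separated′ : SeparatedSet Φ (S [ x ]≔ inside)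
    separated′ u v u∈ v∈ u≢v with ∈-insert⁻ u∈ | ∈-insert⁻ v∈
    ... | inj₁ refl | inj₁ refl = ⊥-elim (u≢v refl)
    ... | inj₁ refl | inj₂ v∈S  = proj₂ (∈-neighbours⁻ Φ v u (Q⊆N v∈S x∈Q))
    ... | inj₂ u∈S  | inj₁ refl = proj₁ (∈-neighbours⁻ Φ u v (Q⊆N u∈S x∈Q))
    ... | inj₂ u∈S  | inj₂ v∈S  = separated u v u∈S v∈S u≢v
    Q⊆N′ : ∀ {u y} → u ∈ S [ x ]≔ inside → y ∈ Q ∩ N → y ∈ neighbours Φ u
    Q⊆N′ u∈ y∈ with ∈-insert⁻ u∈
    ... | inj₁ refl = proj₂ (x∈p∩q⁻ Q N y∈)
    ... | inj₂ u∈S  = Q⊆N u∈S (proj₁ (x∈p∩q⁻ Q N y∈))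

  build : ∀ j → j ≤ suc (suc w) → Partial j
  build zero    _   = start
  build (suc j) j<W = extend (≤-pred j<W) (build j (≤-trans (n≤1+n j) j<W))

∃-sparse-vertex : ∀ {n} (Φ : Fam n) A w m → SeparationBound Φ A (suc w) → ∣ A ∣ ≡ suc m →
  ∃ λ x → x ∈ A × suc w * ∣ A ∩ neighbours Φ x ∣ ≤ w * suc m
∃-sparse-vertex Φ A w m bound ∣A∣≡1+m
  with any? (λ x → x ∈? A ×-dec (suc w * ∣ A ∩ neighbours Φ x ∣ ≤? w * suc m))
... | yes (x , x∈A , sparse) = x , x∈A , sparse
... | no  none = ⊥-elim (<-irrefl refl (subst (_≤ suc w) ∣S∣≡j (bound S S⊆A separated)))
  where
  open Greedy Φ A w m ∣A∣≡1+m (λ x x∈A → ≰⇒> λ sparse → none (x , x∈A , sparse))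
  open Partial (build (suc (suc w)) ≤-refl)

-- Size bounds by induction on the number of active coordinates

record SizeBound (c w : ℕ) (g : ℕ → ℕ) : Set where
  field
    c*∣Φ∣ᶠ≤g∣A∣ : ∀ {n} (Φ : Fam n) A → AgreeOutside Φ A → SeparationBound Φ A w → c * ∣ Φ ∣ᶠ ≤ g ∣ A ∣

open SizeBound

sizeBound-0 : SizeBound 1 0 (λ _ → 1)
c*∣Φ∣ᶠ≤g∣A∣ sizeBound-0 Φ A agree bound =
  subst (_≤ 1) (sym (+-identityʳ _)) (AgreeOutside-∅⇒∣Φ∣ᶠ≤1 Φ A agree (SeparationBound-0⇒∉ Φ A bound))

sizeBound-weaken : ∀ {c w g g′} → (∀ k → g k ≤ g′ k) → SizeBound c w g → SizeBound c w g′
c*∣Φ∣ᶠ≤g∣A∣ (sizeBound-weaken g≤g′ sizeBound) Φ A agree bound =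
  ≤-trans (c*∣Φ∣ᶠ≤g∣A∣ sizeBound Φ A agree bound) (g≤g′ ∣ A ∣)

sizeBound-suc : ∀ {c e w g h} → SizeBound c w g → e * c ≤ h 0 →
  (∀ m d → suc w * d ≤ w * suc m → d ≤ m → h m + e * g d ≤ h (suc m)) → SizeBound (e * c) (suc w) h
c*∣Φ∣ᶠ≤g∣A∣ (sizeBound-suc {c} {e} {w} {g} {h} sizeBound h0 recurrence) Φ A = go ∣ A ∣ Φ A refl
  where
  go : ∀ k {n} (Φ : Fam n) A → ∣ A ∣ ≡ k → AgreeOutside Φ A → SeparationBound Φ A (suc w) → e * c * ∣ Φ ∣ᶠ ≤ h k
  go zero Φ A ∣A∣≡0 agree _ =
    ≤-trans (*-monoʳ-≤ (e * c) (AgreeOutside-∅⇒∣Φ∣ᶠ≤1 Φ A agree λ y∈A →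
                                  <-irrefl (sym ∣A∣≡0) (x∈p⇒0<∣p∣ y∈A)))
            (subst (_≤ h 0) (sym (*-identityʳ _)) h0)
  go (suc m) Φ A ∣A∣≡1+m agree bound with ∃-sparse-vertex Φ A w m bound ∣A∣≡1+m
  ... | x , x∈A , sparse = begin
    e * c * ∣ Φ ∣ᶠ                              ≡⟨ cong (e * c *_) ∣Φ∣ᶠ≡∣shadow∣ᶠ+∣pairs∣ᶠ ⟩
    e * c * (∣ shadow ∣ᶠ + ∣ pairs ∣ᶠ)           ≡⟨ distrib ⟩
    e * c * ∣ shadow ∣ᶠ + e * (c * ∣ pairs ∣ᶠ)   ≤⟨ +-mono-≤ shadowBound (*-monoʳ-≤ e pairsBound) ⟩
    h m + e * g ∣ A ∩ N ∣                        ≤⟨ recurrence m ∣ A ∩ N ∣ sparse ∣A∩N∣≤m ⟩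
    h (suc m)                                    ∎
    where
    open Compression Φ x
    open ≤-Reasoning
    N = neighbours Φ x
    distrib : e * c * (∣ shadow ∣ᶠ + ∣ pairs ∣ᶠ) ≡ e * c * ∣ shadow ∣ᶠ + e * (c * ∣ pairs ∣ᶠ)
    distrib = trans (*-distribˡ-+ (e * c) ∣ shadow ∣ᶠ ∣ pairs ∣ᶠ)
                    (cong (λ k → e * c * ∣ shadow ∣ᶠ + k) (*-assoc e c ∣ pairs ∣ᶠ))
    ∣A-x∣≡m : ∣ A [ x ]≔ outside ∣ ≡ m
    ∣A-x∣≡m = suc-injective (trans (x∈p⇒1+∣p[x]≔outside∣≡∣p∣ A x x∈A) ∣A∣≡1+m)
    A∩N⊆A-x : A ∩ N ⊆ A [ x ]≔ outside
    A∩N⊆A-x {y} y∈A∩N = let y∈A , y∈N = x∈p∩q⁻ A N y∈A∩N in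
      []≔-minimal A y x (λ y≡x → x∉neighbours Φ x (subst (_∈ N) y≡x y∈N)) y∈A
    ∣A∩N∣≤m : ∣ A ∩ N ∣ ≤ m
    ∣A∩N∣≤m = subst (∣ A ∩ N ∣ ≤_) ∣A-x∣≡m (p⊆q⇒∣p∣≤∣q∣ A∩N⊆A-x)
    shadowBound : e * c * ∣ shadow ∣ᶠ ≤ h m
    shadowBound = go m shadow (A [ x ]≔ outside) ∣A-x∣≡m (agreeOutside-shadow agree) (separationBound-shadow bound)
    pairsBound : c * ∣ pairs ∣ᶠ ≤ g ∣ A ∩ N ∣
    pairsBound = c*∣Φ∣ᶠ≤g∣A∣ sizeBound pairs (A ∩ N) (agreeOutside-pairs agree) (separationBound-pairs x∈A bound)

sizeBound-1 : SizeBound 1 1 suc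
sizeBound-1 = sizeBound-suc {e = 1} sizeBound-0 ≤-refl λ m _ _ _ → ≤-reflexive (+-comm (suc m) 1)

halvesProduct : ℕ → ℕ
halvesProduct m = suc ⌊ m /2⌋ * suc ⌈ m /2⌉

sizeBound-2 : SizeBound 1 2 halvesProduct
sizeBound-2 = sizeBound-suc {e = 1} sizeBound-1 ≤-refl recurrence
  where
  growth : ∀ a b → suc a * suc b + suc b ≡ suc b * suc (suc a)
  growth = solve-∀
  recurrence : ∀ m d → 2 * d ≤ 1 * suc m → d ≤ m → halvesProduct m + 1 * suc d ≤ halvesProduct (suc m)
  recurrence m d 2d≤m+1 _ = subst₂ (λ k l → halvesProduct m + k ≤ l) (sym (*-identityˡ (suc d))) (growth ⌊ m /2⌋ ⌈ m /2⌉)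
    (+-monoʳ-≤ (halvesProduct m) (s≤s (≤-trans (≤-reflexive (n≡⌊n+n/2⌋ d))
      (⌊n/2⌋-mono (subst₂ _≤_ (cong (λ k → d + k) (+-identityʳ d)) (+-identityʳ (suc m)) 2d≤m+1)))))

4*halvesProduct≤[m+2]² : ∀ m → 4 * halvesProduct m ≤ (m + 2) * (m + 2)
4*halvesProduct≤[m+2]² zero          = ≤-refl
4*halvesProduct≤[m+2]² (suc zero)    = ≤ᵇ⇒≤ 8 9 _
4*halvesProduct≤[m+2]² (suc (suc m)) = begin
  4 * halvesProduct (suc (suc m))                               ≡⟨ expand ⌊ m /2⌋ ⌈ m /2⌉ ⟩
  4 * halvesProduct m + 4 * (⌊ m /2⌋ + ⌈ m /2⌉) + 12
    ≡⟨ cong (λ k → 4 * halvesProduct m + 4 * k + 12) (⌊n/2⌋+⌈n/2⌉≡n m) ⟩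
  4 * halvesProduct m + 4 * m + 12                              ≤⟨ +-monoˡ-≤ 12 (+-monoˡ-≤ (4 * m) (4*halvesProduct≤[m+2]² m)) ⟩
  (m + 2) * (m + 2) + 4 * m + 12                                ≡⟨ square m ⟩
  (suc (suc m) + 2) * (suc (suc m) + 2)                         ∎
  where
  open ≤-Reasoning
  expand : ∀ a b → 4 * (suc (suc a) * suc (suc b)) ≡ 4 * (suc a * suc b) + 4 * (a + b) + 12
  expand = solve-∀
  square : ∀ m → (m + 2) * (m + 2) + 4 * m + 12 ≡ (suc (suc m) + 2) * (suc (suc m) + 2)
  square = solve-∀

sizeBound-3 : SizeBound 27 3 (λ m → (m + 4) * (m + 4) * (m + 4))
sizeBound-3 = sizeBound-suc {e = 27} sizeBound-2 (≤ᵇ⇒≤ 27 64 _) recurrence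
  where
  open ≤-Reasoning
  square-scale : ∀ d → 9 * ((d + 2) * (d + 2)) ≡ (3 * d + 6) * (3 * d + 6)
  square-scale = solve-∀
  square-halve : ∀ m → (2 * m + 8) * (2 * m + 8) ≡ 4 * ((m + 4) * (m + 4))
  square-halve = solve-∀
  cube-expand : ∀ m → (suc m + 4) * (suc m + 4) * (suc m + 4)
             ≡ (m + 4) * (m + 4) * (m + 4) + 3 * ((m + 4) * (m + 4)) + (3 * (m + 4) + 1)
  cube-expand = solve-∀
  double-suc : ∀ m → 2 * suc m + 6 ≡ 2 * m + 8
  double-suc = solve-∀
  recurrence : ∀ m d → 3 * d ≤ 2 * suc m → d ≤ m →
         (m + 4) * (m + 4) * (m + 4) + 27 * halvesProduct d ≤ (suc m + 4) * (suc m + 4) * (suc m + 4)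
  recurrence m d 3d≤2m+2 _ = begin
    (m + 4) * (m + 4) * (m + 4) + 27 * halvesProduct d
      ≡⟨ cong (λ k → (m + 4) * (m + 4) * (m + 4) + k) (*-assoc 3 9 (halvesProduct d)) ⟩
    (m + 4) * (m + 4) * (m + 4) + 3 * (9 * halvesProduct d)     ≤⟨ +-monoʳ-≤ _ (*-monoʳ-≤ 3 9g≤[m+4]²) ⟩
    (m + 4) * (m + 4) * (m + 4) + 3 * ((m + 4) * (m + 4))       ≤⟨ m≤m+n _ _ ⟩
    (m + 4) * (m + 4) * (m + 4) + 3 * ((m + 4) * (m + 4)) + (3 * (m + 4) + 1) ≡⟨ sym (cube-expand m) ⟩
    (suc m + 4) * (suc m + 4) * (suc m + 4)                     ∎
    where
    3d+6≤2m+8 : 3 * d + 6 ≤ 2 * m + 8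
    3d+6≤2m+8 = subst (3 * d + 6 ≤_) (double-suc m) (+-monoˡ-≤ 6 3d≤2m+2)
    9g≤[m+4]² : 9 * halvesProduct d ≤ (m + 4) * (m + 4)
    9g≤[m+4]² = *-cancelˡ-≤ 4 (subst₂ _≤_ (lemma (halvesProduct d)) (square-halve m)
      (≤-trans (*-monoʳ-≤ 9 (4*halvesProduct≤[m+2]² d))
               (subst (_≤ (2 * m + 8) * (2 * m + 8)) (sym (square-scale d)) (*-mono-≤ 3d+6≤2m+8 3d+6≤2m+8))))
      where lemma : ∀ b → 9 * (4 * b) ≡ 4 * (9 * b)
            lemma = solve-∀

sizeBound-4 : SizeBound (256 * 27) 4 (λ m → 27 * ((m + 7) * (m + 7) * (m + 7) * (m + 7)))
sizeBound-4 = sizeBound-suc {e = 256} sizeBound-3 (≤ᵇ⇒≤ (256 * 27) (27 * (7 * 7 * 7 * 7)) _) recurrence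
  where
  cube-scale : ∀ d → 256 * ((d + 4) * (d + 4) * (d + 4)) ≡ 4 * ((4 * d + 16) * (4 * d + 16) * (4 * d + 16))
  cube-scale = solve-∀
  triple-suc : ∀ m → 3 * suc m + 16 ≡ 3 * m + 19
  triple-suc = solve-∀
  quartic-expand : ∀ m → 27 * ((suc m + 7) * (suc m + 7) * (suc m + 7) * (suc m + 7))
             ≡ 27 * ((m + 7) * (m + 7) * (m + 7) * (m + 7)) + 4 * ((3 * m + 19) * (3 * m + 19) * (3 * m + 19))
               + (378 * m * m + 5256 * m + 18329)
  quartic-expand = solve-∀
  recurrence : ∀ m d → 4 * d ≤ 3 * suc m → d ≤ m →
         27 * ((m + 7) * (m + 7) * (m + 7) * (m + 7)) + 256 * ((d + 4) * (d + 4) * (d + 4))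
         ≤ 27 * ((suc m + 7) * (suc m + 7) * (suc m + 7) * (suc m + 7))
  recurrence m d 4d≤3m+3 _ = subst (27 * ((m + 7) * (m + 7) * (m + 7) * (m + 7)) + 256 * ((d + 4) * (d + 4) * (d + 4)) ≤_) (sym (quartic-expand m))
    (≤-trans (+-monoʳ-≤ (27 * ((m + 7) * (m + 7) * (m + 7) * (m + 7))) 256g≤) (m≤m+n _ _))
    where
    4d+16≤3m+19 : 4 * d + 16 ≤ 3 * m + 19
    4d+16≤3m+19 = subst (4 * d + 16 ≤_) (triple-suc m) (+-monoˡ-≤ 16 4d≤3m+3)
    256g≤ : 256 * ((d + 4) * (d + 4) * (d + 4)) ≤ 4 * ((3 * m + 19) * (3 * m + 19) * (3 * m + 19))
    256g≤ = subst (_≤ 4 * ((3 * m + 19) * (3 * m + 19) * (3 * m + 19))) (sym (cube-scale d))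
              (*-monoʳ-≤ 4 (*-mono-≤ (*-mono-≤ 4d+16≤3m+19 4d+16≤3m+19) 4d+16≤3m+19))

-- The Sauer–Shelah bound

sumBelow : ℕ → (ℕ → ℕ) → ℕ
sumBelow zero    f = 0
sumBelow (suc k) f = f 0 + sumBelow k (f ∘ suc)

sumBelow-cong : ∀ k {f g : ℕ → ℕ} → (∀ i → f i ≡ g i) → sumBelow k f ≡ sumBelow k g
sumBelow-cong zero    _   = refl
sumBelow-cong (suc k) f≗g = cong₂ _+_ (f≗g 0) (sumBelow-cong k (f≗g ∘ suc))

sumBelow-mono : ∀ k {f g : ℕ → ℕ} → (∀ i → f i ≤ g i) → sumBelow k f ≤ sumBelow k g
sumBelow-mono zero    _   = z≤n
sumBelow-mono (suc k) f≤g = +-mono-≤ (f≤g 0) (sumBelow-mono k (f≤g ∘ suc))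

sumBelow-distrib-+ : ∀ k (f g : ℕ → ℕ) → sumBelow k (λ i → f i + g i) ≡ sumBelow k f + sumBelow k g
sumBelow-distrib-+ zero    f g = refl
sumBelow-distrib-+ (suc k) f g rewrite sumBelow-distrib-+ k (f ∘ suc) (g ∘ suc) =
  +-interchange (f 0) (g 0) (sumBelow k (f ∘ suc)) (sumBelow k (g ∘ suc))

C-monoˡ : ∀ {m m′} i → m ≤ m′ → m C i ≤ m′ C i
C-monoˡ {m} i m≤m′ = go (≤⇒≤′ m≤m′)
  where
  go : ∀ {k} → m ≤′ k → m C i ≤ k C i
  go ≤′-refl           = ≤-refl
  go (≤′-step {k} m≤k) = ≤-trans (go m≤k) (C-step k i)
    where
    C-step : ∀ k i → k C i ≤ suc k C i
    C-step k zero    = ≤-refl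
    C-step k (suc j) = subst (k C suc j ≤_) (nCk+nC[k+1]≡[n+1]C[k+1] k j) (m≤n+m _ _)

sauer : ℕ → ℕ → ℕ
sauer w m = sumBelow (suc w) (m C_)

sauer-pascal : ∀ w m → sauer (suc w) (suc m) ≡ sauer (suc w) m + sauer w m
sauer-pascal w m = begin
  1 + sumBelow (suc w) (λ i → suc m C suc i)
    ≡⟨ cong suc (sumBelow-cong (suc w) λ i → sym (nCk+nC[k+1]≡[n+1]C[k+1] m i)) ⟩
  1 + sumBelow (suc w) (λ i → m C i + m C suc i)
    ≡⟨ cong suc (sumBelow-distrib-+ (suc w) (m C_) (λ i → m C suc i)) ⟩
  1 + (sauer w m + sumBelow (suc w) (λ i → m C suc i))             ≡⟨ rearrange (sauer w m) (sumBelow (suc w) (λ i → m C suc i)) ⟩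
  (1 + sumBelow (suc w) (λ i → m C suc i)) + sauer w m             ∎
  where
  open ≡-Reasoning
  rearrange : ∀ a b → 1 + (a + b) ≡ (1 + b) + a
  rearrange = solve-∀

sizeBound-sauer : ∀ w → SizeBound 1 w (sauer w)
sizeBound-sauer zero    = sizeBound-weaken (λ _ → ≤-refl) sizeBound-0
sizeBound-sauer (suc w) = sizeBound-suc {e = 1} (sizeBound-sauer w) (s≤s z≤n) recurrence
  where
  recurrence : ∀ m d → suc w * d ≤ w * suc m → d ≤ m → sauer (suc w) m + 1 * sauer w d ≤ sauer (suc w) (suc m)
  recurrence m d _ d≤m = subst (sauer (suc w) m + 1 * sauer w d ≤_) (sym (sauer-pascal w m))
    (+-monoʳ-≤ (sauer (suc w) m) (subst (_≤ sauer w m) (sym (*-identityˡ _)) (sumBelow-mono (suc w) λ i → C-monoˡ i d≤m)))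

-- Products of chains

allOutside : ∀ a {m} → Subset (a + m) → Bool
allOutside zero    _             = true
allOutside (suc a) (inside ∷ _)  = false
allOutside (suc a) (outside ∷ v) = allOutside a v

-- The members of chain a Ψ are the sets 1ⁱ 0ᵃ⁻ⁱ H with i ≤ a and H a member of Ψ.
chain : ∀ a {m} → Fam m → Fam (a + m)
chain zero    Ψ v             = Ψ v
chain (suc a) Ψ (inside ∷ v)  = chain a Ψ v
chain (suc a) Ψ (outside ∷ v) = allOutside a v ∧ Ψ (drop a v)

∣chain∣ᶠ : ∀ a {m} (Ψ : Fam m) → ∣ chain a Ψ ∣ᶠ ≡ suc a * ∣ Ψ ∣ᶠ
∣chain∣ᶠ zero    Ψ = sym (+-identityʳ _)
∣chain∣ᶠ (suc a) {m} Ψ = cong₂ _+_ (bottom a) (∣chain∣ᶠ a Ψ)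
  where
  bottom : ∀ a → sumSubsets (a + m) (λ v → indicator (allOutside a v ∧ Ψ (drop a v))) ≡ ∣ Ψ ∣ᶠ
  bottom zero    = refl
  bottom (suc a) = trans (cong₂ _+_ (bottom a) (sumSubsets-zero (a + m))) (+-identityʳ _)

chain⁺ : ∀ a {m} (Ψ : Fam m) {v} → T (allOutside a v) → T (Ψ (drop a v)) → T (chain a Ψ v)
chain⁺ zero    Ψ         _ Ψv = Ψv
chain⁺ (suc a) Ψ {outside ∷ v} allOut Ψv = Equivalence.from (T-∧ {allOutside a v}) (allOut , Ψv)

chain⁻ : ∀ a {m} (Ψ : Fam m) {v} → T (chain a Ψ v) → T (Ψ (drop a v))
chain⁻ zero    Ψ               chainv = chainv
chain⁻ (suc a) Ψ {inside ∷ v}  chainv = chain⁻ a Ψ chainv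
chain⁻ (suc a) Ψ {outside ∷ v} chainv = proj₂ (Equivalence.to (T-∧ {allOutside a v}) chainv)

∈-drop⁺ : ∀ a {m} {v : Subset (a + m)} {u} → a ↑ʳ u ∈ v → u ∈ drop a v
∈-drop⁺ zero    u∈          = u∈
∈-drop⁺ (suc a) {v = _ ∷ _} (there u∈) = ∈-drop⁺ a u∈

∈-drop⁻ : ∀ a {m} {v : Subset (a + m)} {u} → u ∈ drop a v → a ↑ʳ u ∈ v
∈-drop⁻ zero    u∈          = u∈
∈-drop⁻ (suc a) {v = _ ∷ _} u∈ = there (∈-drop⁻ a u∈)

allOutside⇒↑ʳ : ∀ a {m} {v : Subset (a + m)} {y} → T (allOutside a v) → y ∈ v → ∃ λ u → y ≡ a ↑ʳ u
allOutside⇒↑ʳ zero    _ _ = _ , refl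
allOutside⇒↑ʳ (suc a) {v = outside ∷ _} allOut (there y∈) =
  let u , y≡ = allOutside⇒↑ʳ a allOut y∈ in u , cong suc y≡

∣drop∣≡∣v∣ : ∀ a {m} (v : Subset (a + m)) → (∀ {y} → y ∈ v → ∃ λ u → y ≡ a ↑ʳ u) →
             ∣ drop a v ∣ ≡ ∣ v ∣
∣drop∣≡∣v∣ zero    v             _      = refl
∣drop∣≡∣v∣ (suc a) (inside ∷ v)  inDrop with inDrop here
... | _ , ()
∣drop∣≡∣v∣ (suc a) (outside ∷ v) inDrop =
  ∣drop∣≡∣v∣ a v λ y∈ → let u , suc-y≡ = inDrop (there y∈) in u , Fin-suc-injective suc-y≡

-- A chain block contributes at most one point to a separated set: of two comparable
-- chain coordinates, the larger one is never separated from the smaller.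
separationBound-chain : ∀ a {m} (Ψ : Fam m) w → SeparationBound Ψ ⊤ w → SeparationBound (chain a Ψ) ⊤ (suc w)
separationBound-chain zero    Ψ w bound S _ separated = m≤n⇒m≤1+n (bound S ⊆⊤ separated)
separationBound-chain (suc a) Ψ w bound (outside ∷ S) _ separated =
  separationBound-chain a Ψ w bound S ⊆⊤ separated′
  where
  separated′ : SeparatedSet (chain a Ψ) S
  separated′ u v u∈ v∈ u≢v with separated (suc u) (suc v) (there u∈) (there v∈) (u≢v ∘ Fin-suc-injective)
  ... | inside ∷ G , chainG , there u∈G , v∉G = G , chainG , u∈G , v∉G ∘ there
  ... | outside ∷ G , chainG , there u∈G , v∉G =
    let allOut , ΨG = Equivalence.to (T-∧ {allOutside a G}) chainG
    in G , chain⁺ a Ψ allOut ΨG , u∈G , v∉G ∘ there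
separationBound-chain (suc a) Ψ w bound (inside ∷ S) _ separated =
  s≤s (subst (_≤ w) (∣drop∣≡∣v∣ a S inRegion) (bound (drop a S) ⊆⊤ separatedΨ))
  where
  inRegion : ∀ {y} → y ∈ S → ∃ λ u → y ≡ a ↑ʳ u
  inRegion {y} y∈ with separated (suc y) zero (there y∈) here (λ ())
  ... | inside ∷ G  , _      , _          , 0∉G = ⊥-elim (0∉G here)
  ... | outside ∷ G , chainG , there y∈G , _   =
    allOutside⇒↑ʳ a (proj₁ (Equivalence.to (T-∧ {allOutside a G}) chainG)) y∈G
  separatedΨ : SeparatedSet Ψ (drop a S)
  separatedΨ u v u∈ v∈ u≢v =
    let G , chainG , u∈G , v∉G = separated (suc (a ↑ʳ u)) (suc (a ↑ʳ v))
                                           (there (∈-drop⁻ a u∈)) (there (∈-drop⁻ a v∈))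
                                           (u≢v ∘ ↑ʳ-injective a u v ∘ Fin-suc-injective)
    in drop (suc a) G , chain⁻ (suc a) Ψ {G} chainG , ∈-drop⁺ (suc a) u∈G , v∉G ∘ ∈-drop⁻ (suc a)

chains : ∀ (bs : List ℕ) → Fam (sum bs)
chains []       _ = true
chains (b ∷ bs)   = chain b (chains bs)

∣chains∣ᶠ : ∀ bs → ∣ chains bs ∣ᶠ ≡ product (map suc bs)
∣chains∣ᶠ []       = refl
∣chains∣ᶠ (b ∷ bs) = trans (∣chain∣ᶠ b (chains bs)) (cong (suc b *_) (∣chains∣ᶠ bs))

separationBound-chains : ∀ bs → SeparationBound (chains bs) ⊤ (length bs)
separationBound-chains []       [] _ _ = z≤n
separationBound-chains (b ∷ bs) = separationBound-chain b (chains bs) (length bs) (separationBound-chains bs)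

enumerate : ∀ n → Fam n → List (Subset n)
enumerate zero    Φ = if Φ [] then [] ∷ [] else []
enumerate (suc n) Φ =
  map (outside ∷_) (enumerate n (Φ ∘ (outside ∷_))) ++ map (inside ∷_) (enumerate n (Φ ∘ (inside ∷_)))

length-enumerate : ∀ n (Φ : Fam n) → length (enumerate n Φ) ≡ ∣ Φ ∣ᶠ
length-enumerate zero Φ with Φ []
... | true  = refl
... | false = refl
length-enumerate (suc n) Φ = begin
  length (map (outside ∷_) outs ++ map (inside ∷_) ins)     ≡⟨ length-++ (map (outside ∷_) outs) ⟩
  length (map (outside ∷_) outs) + length (map (inside ∷_) ins) ≡⟨ cong₂ _+_ (length-map _ outs) (length-map _ ins) ⟩
  length outs + length ins                                   ≡⟨ cong₂ _+_ (length-enumerate n _) (length-enumerate n _) ⟩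
  ∣ Φ ∘ (outside ∷_) ∣ᶠ + ∣ Φ ∘ (inside ∷_) ∣ᶠ              ∎
  where
  open ≡-Reasoning
  outs = enumerate n (Φ ∘ (outside ∷_))
  ins  = enumerate n (Φ ∘ (inside ∷_))

∈-enumerate⁻ : ∀ n (Φ : Fam n) {G} → G ∈ₗ enumerate n Φ → T (Φ G)
∈-enumerate⁻ zero Φ {[]} G∈ with Φ []
∈-enumerate⁻ zero Φ {[]} (here _)  | true = tt
∈-enumerate⁻ zero Φ {[]} (there ()) | true
∈-enumerate⁻ zero Φ {[]} ()         | false
∈-enumerate⁻ (suc n) Φ G∈ with ∈-++⁻ (map (outside ∷_) (enumerate n (Φ ∘ (outside ∷_)))) G∈
... | inj₁ G∈outs with ∈-map⁻ (outside ∷_) G∈outs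
...   | H , H∈ , refl = ∈-enumerate⁻ n _ H∈
∈-enumerate⁻ (suc n) Φ G∈ | inj₂ G∈ins with ∈-map⁻ (inside ∷_) G∈ins
...   | H , H∈ , refl = ∈-enumerate⁻ n _ H∈

enumerate-unique : ∀ n (Φ : Fam n) → Unique (enumerate n Φ)
enumerate-unique zero Φ with Φ []
... | true  = [] ∷ []
... | false = []
enumerate-unique (suc n) Φ =
  Unique.++⁺ (Unique.map⁺ ∷-injectiveʳ (enumerate-unique n _)) (Unique.map⁺ ∷-injectiveʳ (enumerate-unique n _)) disjoint
  where
  disjoint : ∀ {G} → ¬ (G ∈ₗ map (outside ∷_) (enumerate n (Φ ∘ (outside ∷_)))
                      × G ∈ₗ map (inside ∷_) (enumerate n (Φ ∘ (inside ∷_))))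
  disjoint (G∈outs , G∈ins) with ∈-map⁻ (outside ∷_) G∈outs | ∈-map⁻ (inside ∷_) G∈ins
  ... | _ , _ , refl | _ , _ , ()

familyOf : ∀ {n} → Fam n → Family n
familyOf {n} Φ = family (enumerate n Φ) (enumerate-unique n Φ)

_≟ˢ_ : ∀ {n} → (G H : Subset n) → Dec (G ≡ H)
_≟ˢ_ = ≡-dec _≟ᵇ_

_∈ₗ?_ : ∀ {n} (G : Subset n) (Gs : List (Subset n)) → Dec (G ∈ₗ Gs)
G ∈ₗ? Gs = anyₗ? (G ≟ˢ_) Gs

membersOf : ∀ {n} → List (Subset n) → Fam n
membersOf Gs G = does (G ∈ₗ? Gs)

length≤∣membersOf∣ᶠ : ∀ {n} (Gs : List (Subset n)) → Unique Gs → length Gs ≤ ∣ membersOf Gs ∣ᶠ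
length≤∣membersOf∣ᶠ []           _                 = z≤n
length≤∣membersOf∣ᶠ {n} (G ∷ Gs) (G∉Gs ∷ uniqueGs) =
  subst (suc (length Gs) ≤_) (sym split)
    (+-mono-≤ 1≤∣⁅G⁆∣ᶠ (length≤∣membersOf∣ᶠ Gs uniqueGs))
  where
  1≤∣⁅G⁆∣ᶠ : 1 ≤ sumSubsets n (λ v → indicator (does (v ≟ˢ G)))
  1≤∣⁅G⁆∣ᶠ = subst (λ b → indicator b ≤ sumSubsets n (λ v → indicator (does (v ≟ˢ G)))) (dec-true (G ≟ˢ G) refl)
                   (term≤sumSubsets n (λ v → indicator (does (v ≟ˢ G))) G)
  split : ∣ membersOf (G ∷ Gs) ∣ᶠ ≡ sumSubsets n (λ v → indicator (does (v ≟ˢ G))) + ∣ membersOf Gs ∣ᶠ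
  split = trans (sumSubsets-cong n termwise) (sumSubsets-distrib-+ n _ _)
    where
    termwise : ∀ v → indicator (membersOf (G ∷ Gs) v) ≡ indicator (does (v ≟ˢ G)) + indicator (membersOf Gs v)
    termwise v with v ≟ˢ G
    ... | yes refl = cong (suc ∘ indicator) (sym (dec-false (G ∈ₗ? Gs) λ G∈Gs → All.lookup G∉Gs G∈Gs refl))
    ... | no  _    = refl

does⇒ : ∀ {A : Set} (a? : Dec A) → T (does a?) → A
does⇒ (yes a) _ = a

separable? : ∀ {n} t (𝓕 : Family n) → Dec (Separable t 𝓕)
separable? t 𝓕 = anySubset? λ S → (∣ S ∣ ≟ t) ×-dec
  all? (λ x → all? λ y → x ∈? S →-dec (y ∈? S →-dec (¬? (x ≟ᶠ y) →-dec separatedBy? x y)))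
  where
  separatedBy? : ∀ x y → Dec (∃ λ F → F ∈ₗ members 𝓕 × x ∈ F × y ∉ F)
  separatedBy? x y = map′ find (λ (F , F∈ , x∈F×y∉F) → lose F∈ x∈F×y∉F)
                              (anyₗ? (λ F → x ∈? F ×-dec ¬? (y ∈? F)) (members 𝓕))

Separable-familyOf⁻ : ∀ {n} t (Φ : Fam n) → Separable t (familyOf Φ) → ∃ λ S → SeparatedSet Φ S × ∣ S ∣ ≡ t
Separable-familyOf⁻ {n} t Φ (S , ∣S∣≡t , separated) = S , separatedΦ , ∣S∣≡t
  where
  separatedΦ : SeparatedSet Φ S
  separatedΦ x y x∈ y∈ x≢y =
    let F , F∈ , x∈F , y∉F = separated x y x∈ y∈ x≢y in F , ∈-enumerate⁻ n Φ F∈ , x∈F , y∉F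

¬Separable⇒SeparationBound : ∀ {n} w (𝓕 : Family n) → ¬ Separable (suc w) 𝓕 → SeparationBound (membersOf (members 𝓕)) ⊤ w
¬Separable⇒SeparationBound w 𝓕 ¬separable S _ separated with ∣ S ∣ ≤? w
... | yes ∣S∣≤w = ∣S∣≤w
... | no  ∣S∣≰w =
  let S′ , S′⊆S , ∣S′∣≡1+w = ∃-⊆-of-size (suc w) S (≰⇒> ∣S∣≰w)
  in ⊥-elim (¬separable (S′ , ∣S′∣≡1+w , λ x y x∈ y∈ x≢y →
       let F , F∈𝓕 , x∈F , y∉F = separated x y (S′⊆S x∈) (S′⊆S y∈) x≢y
       in F , does⇒ (F ∈ₗ? members 𝓕) F∈𝓕 , x∈F , y∉F))

sizeBound⇒size≤ : ∀ {c w g} → SizeBound c w g → ∀ {n} (𝓕 : Family n) → ¬ Separable (suc w) 𝓕 → c * size 𝓕 ≤ g n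
sizeBound⇒size≤ {c} {w} {g} sizeBound {n} 𝓕 ¬separable =
  ≤-trans (*-monoʳ-≤ c (length≤∣membersOf∣ᶠ (members 𝓕) (distinct 𝓕)))
          (subst (λ k → c * ∣ membersOf (members 𝓕) ∣ᶠ ≤ g k) (∣⊤∣≡n n)
                 (c*∣Φ∣ᶠ≤g∣A∣ sizeBound (membersOf (members 𝓕)) ⊤ (λ _ _ y∉⊤ → ⊥-elim (y∉⊤ ∈⊤))
                              (¬Separable⇒SeparationBound w 𝓕 ¬separable)))

IsSnt⇒size< : ∀ {n t s} → IsSnt n t s → (𝓕 : Family n) → ¬ Separable t 𝓕 → size 𝓕 < s
IsSnt⇒size< {s = s} (allSep , _) 𝓕 ¬separable with s ≤? size 𝓕
... | yes s≤size = ⊥-elim (¬separable (allSep 𝓕 s≤size))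
... | no  s≰size = ≰⇒> s≰size

IsSnt⇒≤1+ : ∀ {n t s} M → IsSnt n t s → (∀ (𝓕 : Family n) → ¬ Separable t 𝓕 → size 𝓕 ≤ M) → s ≤ suc M
IsSnt⇒≤1+ {n} {t} M (_ , minimal) small = minimal (suc M) allSep
  where
  allSep : AllSep n t (suc M)
  allSep 𝓕 M<size with separable? t 𝓕
  ... | yes separable = separable
  ... | no  ¬separable = ⊥-elim (<-irrefl refl (≤-trans M<size (small 𝓕 ¬separable)))

product<s : ∀ bs {n s} → sum bs ≡ n → IsSnt n (suc (length bs)) s → product (map suc bs) < s
product<s bs refl isSnt = subst (_< _) (trans (length-enumerate _ (chains bs)) (∣chains∣ᶠ bs))
  (IsSnt⇒size< isSnt (familyOf (chains bs)) λ separable →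
     let S , separated , ∣S∣≡1+k = Separable-familyOf⁻ _ (chains bs) separable
     in <-irrefl refl (subst (_≤ length bs) ∣S∣≡1+k (separationBound-chains bs S ⊆⊤ separated)))

sizeBound⇒s≤ : ∀ {c w g} .{{_ : NonZero c}} → SizeBound c w g → ∀ {n s} → IsSnt n (suc w) s → c * s ≤ c + g n
sizeBound⇒s≤ {c} {w} {g} sizeBound {n} {s} isSnt = begin
  c * s             ≤⟨ *-monoʳ-≤ c s≤1+M ⟩
  c * suc M         ≡⟨ *-suc c M ⟩
  c + c * M         ≤⟨ +-monoʳ-≤ c (subst (_≤ g n) (*-comm M c) (m/n*n≤m (g n) c)) ⟩
  c + g n           ∎
  where
  open ≤-Reasoning
  M = g n / c
  s≤1+M : s ≤ suc M
  s≤1+M = IsSnt⇒≤1+ M isSnt λ 𝓕 ¬separable → begin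
    size 𝓕              ≡⟨ sym (m*n/n≡m (size 𝓕) c) ⟩
    size 𝓕 * c / c      ≤⟨ /-monoˡ-≤ c (subst (_≤ g n) (*-comm c (size 𝓕)) (sizeBound⇒size≤ sizeBound 𝓕 ¬separable)) ⟩
    M                   ∎

s[n,2]≡n+2 : ∀ {n s} → IsSnt n 2 s → s ≡ n + 2
s[n,2]≡n+2 {n} {s} isSnt = ≤-antisym upper lower
  where
  upper : s ≤ n + 2
  upper = subst₂ _≤_ (+-identityʳ s) (+-comm 2 n) (sizeBound⇒s≤ sizeBound-1 isSnt)
  lower : n + 2 ≤ s
  lower = subst (_≤ s) (trans (cong suc (*-identityʳ (suc n))) (+-comm 2 n)) (product<s (n ∷ []) (+-identityʳ n) isSnt)

⌊n/2⌋*⌈n/2⌉≡n*n/4 : ∀ n → ⌊ n /2⌋ * ⌈ n /2⌉ ≡ n * n / 4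
⌊n/2⌋*⌈n/2⌉≡n*n/4 zero          = refl
⌊n/2⌋*⌈n/2⌉≡n*n/4 (suc zero)    = refl
⌊n/2⌋*⌈n/2⌉≡n*n/4 (suc (suc n)) = begin
  suc ⌊ n /2⌋ * suc ⌈ n /2⌉                 ≡⟨ expand ⌊ n /2⌋ ⌈ n /2⌉ ⟩
  ⌊ n /2⌋ * ⌈ n /2⌉ + suc (⌊ n /2⌋ + ⌈ n /2⌉)
    ≡⟨ cong₂ (λ a b → a + suc b) (⌊n/2⌋*⌈n/2⌉≡n*n/4 n) (⌊n/2⌋+⌈n/2⌉≡n n) ⟩
  n * n / 4 + suc n                          ≡⟨ cong (λ k → n * n / 4 + k) (sym (m*n/n≡m (suc n) 4)) ⟩
  n * n / 4 + suc n * 4 / 4                  ≡⟨ sym (+-distrib-/-∣ʳ (n * n) (n∣m*n (suc n))) ⟩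
  (n * n + suc n * 4) / 4                    ≡⟨ cong (_/ 4) (square n) ⟩
  suc (suc n) * suc (suc n) / 4              ∎
  where
  open ≡-Reasoning
  expand : ∀ a b → suc a * suc b ≡ a * b + suc (a + b)
  expand = solve-∀
  square : ∀ n → n * n + suc n * 4 ≡ suc (suc n) * suc (suc n)
  square = solve-∀

s[n,3]≡⌊n²/4⌋+n+2 : ∀ {n s} → IsSnt n 3 s → s ≡ n * n / 4 + n + 2
s[n,3]≡⌊n²/4⌋+n+2 {n} {s} isSnt = trans (≤-antisym upper lower) closedForm
  where
  upper : s ≤ suc (halvesProduct n)
  upper = subst (_≤ suc (halvesProduct n)) (+-identityʳ s) (sizeBound⇒s≤ sizeBound-2 isSnt)
  lower : suc (halvesProduct n) ≤ s
  lower = subst (λ k → suc k ≤ s) (cong (suc ⌊ n /2⌋ *_) (*-identityʳ (suc ⌈ n /2⌉)))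
            (product<s (⌊ n /2⌋ ∷ ⌈ n /2⌉ ∷ [])
                       (trans (cong (λ k → ⌊ n /2⌋ + k) (+-identityʳ _)) (⌊n/2⌋+⌈n/2⌉≡n n)) isSnt)
  closedForm : suc (halvesProduct n) ≡ n * n / 4 + n + 2
  closedForm = begin
    suc (suc ⌊ n /2⌋ * suc ⌈ n /2⌉)            ≡⟨ expand ⌊ n /2⌋ ⌈ n /2⌉ ⟩
    ⌊ n /2⌋ * ⌈ n /2⌉ + (⌊ n /2⌋ + ⌈ n /2⌉) + 2
      ≡⟨ cong₂ (λ a b → a + b + 2) (⌊n/2⌋*⌈n/2⌉≡n*n/4 n) (⌊n/2⌋+⌈n/2⌉≡n n) ⟩
    n * n / 4 + n + 2                          ∎
    where
    open ≡-Reasoning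
    expand : ∀ a b → suc (suc a * suc b) ≡ a * b + (a + b) + 2
    expand = solve-∀

private
  toℚᵘ-fromℕ : ∀ a → ℚ.toℚᵘ (fromℕ a) ℚᵘ.≃ ℚᵘ.mkℚᵘ (+ a) 0
  toℚᵘ-fromℕ a = ℚ.toℚᵘ-fromℚᵘ (ℚᵘ.mkℚᵘ (+ a) 0)

fromℕ-mono-≤ : ∀ {a b} → a ≤ b → fromℕ a ℚ.≤ fromℕ b
fromℕ-mono-≤ {a} {b} a≤b = ℚ.toℚᵘ-cancel-≤
  (ℚᵘ.≤-respˡ-≃ (ℚᵘ.≃-sym (toℚᵘ-fromℕ a)) (ℚᵘ.≤-respʳ-≃ (ℚᵘ.≃-sym (toℚᵘ-fromℕ b))
    (ℚᵘ.*≤* (subst₂ ℤ._≤_ (sym (ℤ.*-identityʳ (+ a))) (sym (ℤ.*-identityʳ (+ b))) (ℤ.+≤+ a≤b)))))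

fromℕ-mono-< : ∀ {a b} → a < b → fromℕ a ℚ.< fromℕ b
fromℕ-mono-< {a} {b} a<b = ℚ.toℚᵘ-cancel-<
  (ℚᵘ.<-respˡ-≃ (ℚᵘ.≃-sym (toℚᵘ-fromℕ a)) (ℚᵘ.<-respʳ-≃ (ℚᵘ.≃-sym (toℚᵘ-fromℕ b))
    (ℚᵘ.*<* (subst₂ ℤ._<_ (sym (ℤ.*-identityʳ (+ a))) (sym (ℤ.*-identityʳ (+ b))) (ℤ.+<+ a<b)))))

fromℕ-+ : ∀ a b → fromℕ (a + b) ≡ fromℕ a ℚ.+ fromℕ b
fromℕ-+ a b = ℚ.toℚᵘ-injective (ℚᵘ.≃-trans (toℚᵘ-fromℕ (a + b)) (ℚᵘ.≃-trans homo
  (ℚᵘ.≃-sym (ℚᵘ.≃-trans (ℚ.toℚᵘ-homo-+ (fromℕ a) (fromℕ b)) (ℚᵘ.+-cong (toℚᵘ-fromℕ a) (toℚᵘ-fromℕ b))))))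
  where
  identity : ∀ x y → (x ℤ.+ y) ℤ.* ℤ.1ℤ ≡ (x ℤ.* ℤ.1ℤ ℤ.+ y ℤ.* ℤ.1ℤ) ℤ.* ℤ.1ℤ
  identity = ℤ-solve-∀
  homo : ℚᵘ.mkℚᵘ (+ (a + b)) 0 ℚᵘ.≃ ℚᵘ.mkℚᵘ (+ a) 0 ℚᵘ.+ ℚᵘ.mkℚᵘ (+ b) 0
  homo = ℚᵘ.*≡* (trans (cong (ℤ._* ℤ.1ℤ) (ℤ.pos-+ a b)) (identity (+ a) (+ b)))

fromℕ-* : ∀ a b → fromℕ (a * b) ≡ fromℕ a ℚ.* fromℕ b
fromℕ-* a b = ℚ.toℚᵘ-injective (ℚᵘ.≃-trans (toℚᵘ-fromℕ (a * b)) (ℚᵘ.≃-trans homo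
  (ℚᵘ.≃-sym (ℚᵘ.≃-trans (ℚ.toℚᵘ-homo-* (fromℕ a) (fromℕ b)) (ℚᵘ.*-cong (toℚᵘ-fromℕ a) (toℚᵘ-fromℕ b))))))
  where
  homo : ℚᵘ.mkℚᵘ (+ (a * b)) 0 ℚᵘ.≃ ℚᵘ.mkℚᵘ (+ a) 0 ℚᵘ.* ℚᵘ.mkℚᵘ (+ b) 0
  homo = ℚᵘ.*≡* (cong (ℤ._* ℤ.1ℤ) (ℤ.pos-* a b))

fromℕ-^ : ∀ a e → fromℕ a ^ℚ e ≡ fromℕ (a ^ e)
fromℕ-^ a zero    = refl
fromℕ-^ a (suc e) = trans (cong (fromℕ a ℚ.*_) (fromℕ-^ a e)) (sym (fromℕ-* a (a ^ e)))

n/[1+d]*[1+d]≡n : ∀ n d → (+ n ℚ./ suc d) ℚ.* fromℕ (suc d) ≡ fromℕ n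
n/[1+d]*[1+d]≡n n d = ℚ.toℚᵘ-injective (ℚᵘ.≃-trans (ℚ.toℚᵘ-homo-* (+ n ℚ./ suc d) (fromℕ (suc d)))
  (ℚᵘ.≃-trans (ℚᵘ.*-cong (ℚ.toℚᵘ-fromℚᵘ (ℚᵘ.mkℚᵘ (+ n) d)) (toℚᵘ-fromℕ (suc d)))
    (ℚᵘ.≃-trans cancel (ℚᵘ.≃-sym (toℚᵘ-fromℕ n)))))
  where
  cancel : ℚᵘ.mkℚᵘ (+ n) d ℚᵘ.* ℚᵘ.mkℚᵘ (+ suc d) 0 ℚᵘ.≃ ℚᵘ.mkℚᵘ (+ n) 0
  cancel = ℚᵘ.*≡* (trans (ℤ.*-identityʳ _) (cong (λ k → + n ℤ.* + k) (sym (*-identityʳ (suc d)))))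

open +-*-Solver using (solve; _:=_; _:+_; _:*_; _:-_; :-_)

^ℚ-distrib-* : ∀ a b e → (a ^ℚ e) ℚ.* (b ^ℚ e) ≡ (a ℚ.* b) ^ℚ e
^ℚ-distrib-* a b zero    = refl
^ℚ-distrib-* a b (suc e) =
  trans (solve 4 (λ a b x y → (a :* x) :* (b :* y) := (a :* b) :* (x :* y)) refl a b (a ^ℚ e) (b ^ℚ e))
        (cong ((a ℚ.* b) ℚ.*_) (^ℚ-distrib-* a b e))

1^ℚe≡1 : ∀ e → 1ℚ ^ℚ e ≡ 1ℚ
1^ℚe≡1 zero    = refl
1^ℚe≡1 (suc e) = trans (ℚ.*-identityˡ _) (1^ℚe≡1 e)

-- Comparisons with (n / e)ᵉ, e = 1 + d, reduced to ℕ by multiplying through by R = eᵉ.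
module Rescaling (d : ℕ) where

  private
    e = suc d
    R = fromℕ e ^ℚ e

  K : ℚ
  K = (+ 1 ℚ./ e) ^ℚ e

  private
    R≡eᵉ : R ≡ fromℕ (e ^ e)
    R≡eᵉ = fromℕ-^ e e

    K*R≡1 : K ℚ.* R ≡ 1ℚ
    K*R≡1 = trans (^ℚ-distrib-* (ℤ.+ 1 ℚ./ e) (fromℕ e) e) (trans (cong (_^ℚ e) (n/[1+d]*[1+d]≡n 1 d)) (1^ℚe≡1 e))

    [n/e]ᵉ*R≡nᵉ : ∀ n → ((+ n ℚ./ e) ^ℚ e) ℚ.* R ≡ fromℕ (n ^ e)
    [n/e]ᵉ*R≡nᵉ n = trans (^ℚ-distrib-* (ℤ.+ n ℚ./ e) (fromℕ e) e)
                          (trans (cong (_^ℚ e) (n/[1+d]*[1+d]≡n n d)) (fromℕ-^ n e))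

    instance
      R-positive : ℚ.Positive R
      R-positive = ℚ.positive (subst (0ℚ ℚ.<_) (sym R≡eᵉ) (fromℕ-mono-< (m^n>0 e e)))

    scaled-term : ∀ p Y → R ℚ.* ((fromℕ p ℚ.* K) ℚ.* fromℕ Y) ≡ fromℕ (p * Y)
    scaled-term p Y =
      trans (solve 4 (λ r k p y → r :* ((p :* k) :* y) := (k :* r) :* (p :* y)) refl R K (fromℕ p) (fromℕ Y))
            (trans (cong (ℚ._* (fromℕ p ℚ.* fromℕ Y)) K*R≡1) (trans (ℚ.*-identityˡ _) (sym (fromℕ-* p Y))))

    scaled-difference : ∀ n s → R ℚ.* (fromℕ s ℚ.- ((+ n ℚ./ e) ^ℚ e)) ≡ fromℕ (e ^ e * s) ℚ.- fromℕ (n ^ e)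
    scaled-difference n s =
      trans (solve 3 (λ r s x → r :* (s :- x) := (r :* s) :- (x :* r)) refl R (fromℕ s) ((+ n ℚ./ e) ^ℚ e))
            (cong₂ ℚ._-_ (trans (cong (ℚ._* fromℕ s) R≡eᵉ) (sym (fromℕ-* (e ^ e) s))) ([n/e]ᵉ*R≡nᵉ n))

    a+b≤c⇒b≤c-a : ∀ a b c → a ℚ.+ b ℚ.≤ c → b ℚ.≤ c ℚ.- a
    a+b≤c⇒b≤c-a a b c a+b≤c =
      subst (ℚ._≤ c ℚ.- a) (solve 2 (λ a b → (a :+ b) :+ (:- a) := b) refl a b) (ℚ.+-monoˡ-≤ (ℚ.- a) a+b≤c)

    c≤a+b⇒c-a≤b : ∀ a b c → c ℚ.≤ a ℚ.+ b → c ℚ.- a ℚ.≤ b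
    c≤a+b⇒c-a≤b a b c c≤a+b =
      subst (c ℚ.- a ℚ.≤_) (solve 2 (λ a b → (a :+ b) :+ (:- a) := b) refl a b) (ℚ.+-monoˡ-≤ (ℚ.- a) c≤a+b)

  [n/e]ᵉ<s : ∀ n s → n ^ e < e ^ e * s → (+ n ℚ./ e) ^ℚ e ℚ.< fromℕ s
  [n/e]ᵉ<s n s nᵉ<eᵉs = ℚ.*-cancelʳ-<-nonNeg R {{ℚ.pos⇒nonNeg R}}
    (subst₂ ℚ._<_ (sym ([n/e]ᵉ*R≡nᵉ n))
                  (trans (fromℕ-* (e ^ e) s) (trans (cong (ℚ._* fromℕ s) (sym R≡eᵉ)) (ℚ.*-comm R (fromℕ s))))
      (fromℕ-mono-< nᵉ<eᵉs))

  pK*nᵐ≤s-[n/e]ᵉ : ∀ m n s p → n ^ e + p * n ^ m ≤ e ^ e * s →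
    (fromℕ p ℚ.* K) ℚ.* fromℕ (n ^ m) ℚ.≤ fromℕ s ℚ.- ((+ n ℚ./ e) ^ℚ e)
  pK*nᵐ≤s-[n/e]ᵉ m n s p bound = ℚ.*-cancelˡ-≤-pos R
    (subst₂ ℚ._≤_ (sym (scaled-term p (n ^ m))) (sym (scaled-difference n s))
      (a+b≤c⇒b≤c-a (fromℕ (n ^ e)) (fromℕ (p * n ^ m)) (fromℕ (e ^ e * s))
        (subst (ℚ._≤ fromℕ (e ^ e * s)) (fromℕ-+ (n ^ e) (p * n ^ m)) (fromℕ-mono-≤ bound))))

  s-[n/e]ᵉ≤qK*nᵐ : ∀ m n s q → e ^ e * s ≤ n ^ e + q * n ^ m →
    fromℕ s ℚ.- ((+ n ℚ./ e) ^ℚ e) ℚ.≤ (fromℕ q ℚ.* K) ℚ.* fromℕ (n ^ m)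
  s-[n/e]ᵉ≤qK*nᵐ m n s q bound = ℚ.*-cancelˡ-≤-pos R
    (subst₂ ℚ._≤_ (sym (scaled-difference n s)) (sym (scaled-term q (n ^ m)))
      (c≤a+b⇒c-a≤b (fromℕ (n ^ e)) (fromℕ (q * n ^ m)) (fromℕ (e ^ e * s))
        (subst (fromℕ (e ^ e * s) ℚ.≤_) (fromℕ-+ (n ^ e) (q * n ^ m)) (fromℕ-mono-≤ bound))))

^-distribʳ-* : ∀ m n o → (m * n) ^ o ≡ m ^ o * n ^ o
^-distribʳ-* m n zero    = refl
^-distribʳ-* m n (suc o) = trans (cong (m * n *_) (^-distribʳ-* m n o)) (interchange m n (m ^ o) (n ^ o))
  where
  interchange : ∀ a b c d → a * b * (c * d) ≡ a * c * (b * d)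
  interchange = solve-∀

sum-replicate : ∀ w q → sum (replicate w q) ≡ w * q
sum-replicate zero    q = refl
sum-replicate (suc w) q = cong (λ k → q + k) (sum-replicate w q)

product-map-suc-replicate : ∀ w q → product (map suc (replicate w q)) ≡ suc q ^ w
product-map-suc-replicate zero    q = refl
product-map-suc-replicate (suc w) q = cong (suc q *_) (product-map-suc-replicate w q)

-- Split n = e q + r with r < e into blocks q + r, q, …, q.
[1+n]ᵉ≤eᵉ*s : ∀ w {n s} → IsSnt n (suc (suc w)) s → suc n ^ suc w ≤ suc w ^ suc w * s
[1+n]ᵉ≤eᵉ*s w {n} {s} isSnt = begin
  suc n ^ e                      ≤⟨ ^-monoˡ-≤ e 1+n≤e*[1+q] ⟩
  (e * suc q) ^ e                ≡⟨ ^-distribʳ-* e (suc q) e ⟩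
  e ^ e * suc q ^ e              ≤⟨ *-monoʳ-≤ (e ^ e) [1+q]ᵉ≤s ⟩
  e ^ e * s                      ∎
  where
  open ≤-Reasoning
  e = suc w
  q = n / e
  r = n % e
  blocks : List ℕ
  blocks = q + r ∷ replicate w q
  n≡r+q*e : n ≡ r + q * e
  n≡r+q*e = m≡m%n+[m/n]*n n e
  1+n≤e*[1+q] : suc n ≤ e * suc q
  1+n≤e*[1+q] = subst₂ _≤_ (cong suc (sym n≡r+q*e)) (regroup q w)
                  (+-monoˡ-≤ (q * e) (m%n<n n e))
    where
    regroup : ∀ q w → suc w + q * suc w ≡ suc w * suc q
    regroup = solve-∀
  ∑blocks≡n : sum blocks ≡ n
  ∑blocks≡n = trans (cong (λ k → q + r + k) (sum-replicate w q)) (trans (regroup q r w) (sym n≡r+q*e))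
    where
    regroup : ∀ q r w → q + r + w * q ≡ r + q * suc w
    regroup = solve-∀
  [1+q]ᵉ≤s : suc q ^ e ≤ s
  [1+q]ᵉ≤s = ≤-trans (subst (suc q * suc q ^ w ≤_) (cong (suc (q + r) *_) (sym (product-map-suc-replicate w q)))
                               (*-monoˡ-≤ (suc q ^ w) (s≤s (m≤m+n q r))))
                     (<⇒≤ (product<s blocks ∑blocks≡n
                                     (subst (λ k → IsSnt n (suc (suc k)) s) (sym (length-replicate w)) isSnt)))

s[n,4]-lower : ∀ {n s} → IsSnt n 4 s → n ^ 3 + 3 * n ^ 2 ≤ 3 ^ 3 * s
s[n,4]-lower {n} isSnt = ≤-trans (subst (n ^ 3 + 3 * n ^ 2 ≤_) (binomial n) (m≤m+n _ _)) ([1+n]ᵉ≤eᵉ*s 2 isSnt)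
  where
  binomial : ∀ n → n * (n * (n * 1)) + 3 * (n * (n * 1)) + (3 * n + 1) ≡ suc n * (suc n * (suc n * 1))
  binomial = solve-∀

s[n,4]-upper : ∀ {k s} → IsSnt (suc k) 4 s → 3 ^ 3 * s ≤ suc k ^ 3 + 162 * suc k ^ 2
s[n,4]-upper {k} {s} isSnt = ≤-trans (sizeBound⇒s≤ sizeBound-3 {suc k} {s} isSnt) (slack k)
  where
  identity : ∀ k → 27 + (suc k + 4) * (suc k + 4) * (suc k + 4) + (150 * k * k + 252 * k + 11)
                   ≡ suc k * (suc k * (suc k * 1)) + 162 * (suc k * (suc k * 1))
  identity = solve-∀
  slack : ∀ k → 27 + (suc k + 4) * (suc k + 4) * (suc k + 4) ≤ suc k ^ 3 + 162 * suc k ^ 2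
  slack k = subst (27 + (suc k + 4) * (suc k + 4) * (suc k + 4) ≤_) (identity k) (m≤m+n _ _)

s[n,5]-lower : ∀ {n s} → IsSnt n 5 s → n ^ 4 + 4 * n ^ 3 ≤ 4 ^ 4 * s
s[n,5]-lower {n} isSnt = ≤-trans (subst (n ^ 4 + 4 * n ^ 3 ≤_) (binomial n) (m≤m+n _ _)) ([1+n]ᵉ≤eᵉ*s 3 isSnt)
  where
  binomial : ∀ n → n * (n * (n * (n * 1))) + 4 * (n * (n * (n * 1))) + (6 * (n * n) + 4 * n + 1)
                   ≡ suc n * (suc n * (suc n * (suc n * 1)))
  binomial = solve-∀

s[n,5]-upper : ∀ {k s} → IsSnt (suc k) 5 s → 4 ^ 4 * s ≤ suc k ^ 4 + 4400 * suc k ^ 3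
s[n,5]-upper {k} isSnt = ≤-trans (256s≤256+[n+7]⁴ isSnt) (slack k)
  where
  256s≤256+[n+7]⁴ : ∀ {n s} → IsSnt n 5 s → 256 * s ≤ 256 + (n + 7) * (n + 7) * (n + 7) * (n + 7)
  256s≤256+[n+7]⁴ {n} {s} isSnt =
    *-cancelˡ-≤ 27 (subst₂ _≤_ (factorˡ s) (factorʳ ((n + 7) * (n + 7) * (n + 7) * (n + 7)))
                             (sizeBound⇒s≤ sizeBound-4 {n} {s} isSnt))
    where
    factorˡ : ∀ s → 256 * 27 * s ≡ 27 * (256 * s)
    factorˡ = solve-∀
    factorʳ : ∀ x → 256 * 27 + 27 * x ≡ 27 * (256 + x)
    factorʳ = solve-∀
  identity : ∀ k → 256 + (suc k + 7) * (suc k + 7) * (suc k + 7) * (suc k + 7)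
                     + (4372 * k * k * k + 12822 * k * k + 11156 * k + 49)
                   ≡ suc k * (suc k * (suc k * (suc k * 1))) + 4400 * (suc k * (suc k * (suc k * 1)))
  identity = solve-∀
  slack : ∀ k → 256 + (suc k + 7) * (suc k + 7) * (suc k + 7) * (suc k + 7) ≤ suc k ^ 4 + 4400 * suc k ^ 3
  slack k = subst (256 + (suc k + 7) * (suc k + 7) * (suc k + 7) * (suc k + 7) ≤_) (identity k) (m≤m+n _ _)

sum-map-applyUpTo : ∀ (g f : ℕ → ℕ) m → sum (map g (applyUpTo f m)) ≡ sumBelow m (g ∘ f)
sum-map-applyUpTo g f zero    = refl
sum-map-applyUpTo g f (suc m) = cong (λ k → g (f 0) + k) (sum-map-applyUpTo g (f ∘ suc) m)

s[n,t]-lower : ∀ d {n s} → IsSnt n (2 + d) s → n ^ suc d < suc d ^ suc d * s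
s[n,t]-lower d {n} isSnt = <-≤-trans (^-monoˡ-< (suc d) (n<1+n n)) ([1+n]ᵉ≤eᵉ*s d isSnt)

s[n,t]-upper : ∀ w {n s} → IsSnt n (suc w) s → s ≤ 1 + sum (map (n C_) (upTo (suc w)))
s[n,t]-upper w {n} {s} isSnt =
  subst₂ _≤_ (+-identityʳ s) (cong suc (sym (sum-map-applyUpTo (n C_) (λ i → i) (suc w))))
         (sizeBound⇒s≤ (sizeBound-sauer w) isSnt)

theorem6 :
  -- (i) s(n,2) = n + 2
  (∀ n → n ≥ 2 → ∀ s → IsSnt n 2 s → s ≡ n + 2)
  ×
  -- (ii) s(n,3) = ⌊n²/4⌋ + n + 2
  (∀ n → n ≥ 3 → ∀ s → IsSnt n 3 s → s ≡ (n * n) / 4 + n + 2)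
  ×
  -- (iii) t = 4 : s(n,4) = (n/3)^3 + Θ(n^2)
  (∃[ c₁ ] ∃[ c₂ ] (0ℚ ℚ.< c₁ × 0ℚ ℚ.< c₂ × ∃[ N ] (∀ n → n ≥ N → n ≥ 4 → ∀ s → IsSnt n 4 s →
      (c₁ ℚ.* fromℕ (n ^ 2) ℚ.≤ fromℕ s ℚ.- ((+ n ℚ./ 3) ^ℚ 3))
      × (fromℕ s ℚ.- ((+ n ℚ./ 3) ^ℚ 3) ℚ.≤ c₂ ℚ.* fromℕ (n ^ 2)))))
  ×
  -- (iii) t = 5 : s(n,5) = (n/4)^4 + Θ(n^3)
  (∃[ c₁ ] ∃[ c₂ ] (0ℚ ℚ.< c₁ × 0ℚ ℚ.< c₂ × ∃[ N ] (∀ n → n ≥ N → n ≥ 5 → ∀ s → IsSnt n 5 s →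
      (c₁ ℚ.* fromℕ (n ^ 3) ℚ.≤ fromℕ s ℚ.- ((+ n ℚ./ 4) ^ℚ 4))
      × (fromℕ s ℚ.- ((+ n ℚ./ 4) ^ℚ 4) ℚ.≤ c₂ ℚ.* fromℕ (n ^ 3)))))
  ×
  -- (iv) t = 6 + k ≥ 6 : (n/(t-1))^(t-1) < s(n,t) ≤ 1 + Σ_{i<t} C(n,i)
  (∀ k n → n ≥ 6 + k → ∀ s → IsSnt n (6 + k) s →
      (((+ n ℚ./ (5 + k)) ^ℚ (5 + k)) ℚ.< fromℕ s)
      × (s ≤ 1 + sum (map (λ i → n C i) (upTo (6 + k)))))
-- K d = (1 + d)⁻⁽¹⁺ᵈ⁾, so the constants are 3/3³, 162/3³ for t = 4 and 4/4⁴, 4400/4⁴ for t = 5.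
theorem6 =
    (λ _ _ _ → s[n,2]≡n+2)
  , (λ _ _ _ → s[n,3]≡⌊n²/4⌋+n+2)
  , (fromℕ 3 ℚ.* K 2 , fromℕ 162 ℚ.* K 2 , positive (fromℕ 3 ℚ.* K 2) , positive (fromℕ 162 ℚ.* K 2) , 0 ,
     λ { zero _ () ; (suc k) _ _ s isSnt →
           pK*nᵐ≤s-[n/e]ᵉ 2 2 (suc k) s 3 (s[n,4]-lower isSnt) , s-[n/e]ᵉ≤qK*nᵐ 2 2 (suc k) s 162 (s[n,4]-upper isSnt) })
  , (fromℕ 4 ℚ.* K 3 , fromℕ 4400 ℚ.* K 3 , positive (fromℕ 4 ℚ.* K 3) , positive (fromℕ 4400 ℚ.* K 3) , 0 ,
     λ { zero _ () ; (suc k) _ _ s isSnt →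
           pK*nᵐ≤s-[n/e]ᵉ 3 3 (suc k) s 4 (s[n,5]-lower isSnt) , s-[n/e]ᵉ≤qK*nᵐ 3 3 (suc k) s 4400 (s[n,5]-upper isSnt) })
  , λ k n _ s isSnt → [n/e]ᵉ<s (4 + k) n s (s[n,t]-lower (4 + k) isSnt) , s[n,t]-upper (5 + k) isSnt
  where
  open Rescaling
  positive : ∀ c → {True (0ℚ ℚ.<? c)} → 0ℚ ℚ.< c
  positive c {0<c} = toWitness 0<c
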